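{- The linear map $\phi:\mathcal{Q}\to\overleftarrow{Q}$, $\mathbf{a}\mapsto \overleftarrow{\mathfrak{F}}_{\mathbf{a}}$, is a surjective ring homomorphism, with kernel spanned by the formal differences $\boldsymbol{p}-\boldsymbol{q}$, where $\boldsymbol{p}\equiv\boldsymbol{q}$.
   Context: Colored words are finite words over $\overline{\mathbb{Z}}=\{i^{[j]} : i\in\mathbb{Z}, j\in\mathbb{Z}_+\}$ (value $i$, color $j$), totally ordered by value then color. The colored shuffle product is $\boldsymbol{p}\boldsymbol{q} := \boldsymbol{p} \sqcup\!\sqcup (\boldsymbol{q}\uparrow \operatorname{maxcol}(\boldsymbol{p}))$, where $\sqcup\!\sqcup$ is the Eilenberg–Mac Lane shuffle product (sum of all order-preserving interlacings), $\operatorname{maxcol}$ is the largest color and $\uparrow a$ adds $a$ to all colors; $\mathcal{Q}=\mathbb{Q}[\overline{\mathbb{Z}}^*]$ is the resulting algebra. A compatible sequence with top row $\boldsymbol{t}\in\overline{\mathbb{Z}}^k$ is a bottom row $\boldsymbol{b}\in\mathbb{Z}^k$ that is weakly increasing, satisfies $b_j\le t_j$ (comparing values), and $t_j<t_{j+1}\Rightarrow b_j<b_{j+1}$. The back-stable slide polynomial is $\overleftarrow{\mathfrak{F}}_{\boldsymbol{t}}=\sum_{\boldsymbol{b}}x_{b_1}\cdots x_{b_k}$ over such bottom rows, extended linearly to $\mathbf{a}\in\mathcal{Q}$; $\overleftarrow{Q}$ is the ring of back-quasisymmetric functions. The maximal bottom row $m(\boldsymbol{t})$ is given by $m(\boldsymbol{t})_k=\mathrm{val}(t_k)$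 and, for $j<k$, $m(\boldsymbol{t})_j=m(\boldsymbol{t})_{j+1}$ if $t_j\ge t_{j+1}$, else $\min(\mathrm{val}(t_j),m(\boldsymbol{t})_{j+1}-1)$; and $\boldsymbol{p}\equiv\boldsymbol{q}$ means $m(\boldsymbol{p})=m(\boldsymbol{q})$. Known inputs: $\overleftarrow{\mathfrak{F}}_{\mathbf{a}}\overleftarrow{\mathfrak{F}}_{\mathbf{b}}=\overleftarrow{\mathfrak{F}}_{\mathbf{a}\mathbf{b}}$, and $\{\overleftarrow{\mathfrak{F}}_{\boldsymbol{p}}:\boldsymbol{p}$ weakly increasing in $\mathbb{Z}^*\}$ is a basis of $\overleftarrow{Q}$. -}

module Defs where

open import Data.Bool using (Bool; true; false; if_then_else_; _∧_; _∨_)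
open import Data.Nat as ℕ using (ℕ; zero; suc)
open import Data.Integer as ℤ using (ℤ; _≤ᵇ_)
open import Data.Integer.Properties as ℤP using ()
open import Data.Rational as ℚ using (ℚ; 0ℚ; 1ℚ)
open import Data.Product using (Σ; ∃; ∃-syntax; _×_; _,_; proj₁; proj₂)
open import Data.Product.Properties as ×P using ()
open import Data.List using (List; []; _∷_; _++_; map; foldr; concatMap; filter; length; deduplicate)
open import Data.List.Properties as LP using ()
open import Data.List.Relation.Unary.Linked using (Linked)
open import Data.List.Relation.Unary.All using (All)
open import Relation.Nullary using (¬_)
open import Relation.Binary.PropositionalEquality using (_≡_)

-- Colored letters and colored words
-- A letter i^[j] is (i , k) with i : ℤ its value and colour j = suc k,
-- so that colours range over the positive integers ℤ₊.

Letter : Set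
Letter = ℤ × ℕ

val : Letter → ℤ
val = proj₁

colour : Letter → ℕ
colour (_ , k) = suc k

CWord : Set
CWord = List Letter

_<L_ : Letter → Letter → Bool
(i , k) <L (i' , k') = ((ℤ.suc i) ≤ᵇ i') ∨ ((i ≤ᵇ i') ∧ (i' ≤ᵇ i) ∧ (suc k ℕ.≤ᵇ k'))

maxcol : CWord → ℕ
maxcol []      = 0
maxcol (l ∷ w) = colour l ℕ.⊔ maxcol w

_↑_ : CWord → ℕ → CWord
w ↑ a = map (λ { (i , k) → (i , k ℕ.+ a) }) w

shuffle : {A : Set} → List A → List A → List (List A)
shuffle []       ys       = ys ∷ []
shuffle (x ∷ xs) []       = (x ∷ xs) ∷ []
shuffle (x ∷ xs) (y ∷ ys) =
  map (x ∷_) (shuffle xs (y ∷ ys)) ++ map (y ∷_) (shuffle (x ∷ xs) ys)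

-- The algebra 𝒬 = ℚ[colored words]: an element is a finite formal
-- ℚ-linear combination, represented by a list of (coefficient, word);
-- two representatives are equal when all coefficients agree.

𝒬 : Set
𝒬 = List (ℚ × CWord)

sumℚ : List ℚ → ℚ
sumℚ = foldr ℚ._+_ 0ℚ

DecEqCWord : (u v : CWord) → Data.Bool.Bool
DecEqCWord u v = Relation.Nullary.Decidable.⌊ LP.≡-dec (×P.≡-dec ℤ._≟_ ℕ._≟_) u v ⌋
  where import Relation.Nullary.Decidable

coeff𝒬 : 𝒬 → CWord → ℚ
coeff𝒬 a w = sumℚ (map (λ { (c , u) → if DecEqCWord u w then c else 0ℚ }) a)

_≈𝒬_ : 𝒬 → 𝒬 → Set
a ≈𝒬 b = ∀ w → coeff𝒬 a w ≡ coeff𝒬 b w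

word : CWord → 𝒬
word w = (1ℚ , w) ∷ []

1𝒬 : 𝒬
1𝒬 = word []

_+𝒬_ : 𝒬 → 𝒬 → 𝒬
_+𝒬_ = _++_

_·𝒬_ : ℚ → 𝒬 → 𝒬
c ·𝒬 a = map (λ { (d , w) → (c ℚ.* d , w) }) a

_-𝒬_ : 𝒬 → 𝒬 → 𝒬
a -𝒬 b = a +𝒬 ((ℚ.- 1ℚ) ·𝒬 b)

cprod : CWord → CWord → List CWord
cprod p q = shuffle p (q ↑ maxcol p)

_*𝒬_ : 𝒬 → 𝒬 → 𝒬
a *𝒬 b = concatMap (λ { (c , p) →
           concatMap (λ { (d , q) → map (λ w → (c ℚ.* d , w)) (cprod p q) }) b }) a

-- A monomial
-- x_{b₁}⋯x_{b_k} is the weakly increasing list b₁ ≤ … ≤ b_k; a series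
-- is its coefficient function (values on non-sorted lists are ignored).

Sorted : List ℤ → Set
Sorted = Linked ℤ._≤_

PS : Set
PS = List ℤ → ℚ

_≈PS_ : PS → PS → Set
f ≈PS g = ∀ m → Sorted m → f m ≡ g m

0PS : PS
0PS _ = 0ℚ

1PS : PS
1PS []      = 1ℚ
1PS (_ ∷ _) = 0ℚ

_+PS_ : PS → PS → PS
(f +PS g) m = f m ℚ.+ g m

splits : List ℤ → List (List ℤ × List ℤ)
splits []      = ([] , []) ∷ []
splits (x ∷ m) = concatMap (λ { (u , v) → (x ∷ u , v) ∷ (u , x ∷ v) ∷ [] }) (splits m)

factorisations : List ℤ → List (List ℤ × List ℤ)
factorisations m = deduplicate (×P.≡-dec (LP.≡-dec ℤ._≟_) (LP.≡-dec ℤ._≟_)) (splits m)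

_*PS_ : PS → PS → PS
(f *PS g) m = sumℚ (map (λ { (u , v) → f u ℚ.* g v }) (factorisations m))

compatible : CWord → List ℤ → Bool
compatible []            []            = true
compatible (t ∷ [])      (b ∷ [])      = b ≤ᵇ val t
compatible (t ∷ t' ∷ ts) (b ∷ b' ∷ bs) =
  (b ≤ᵇ val t) ∧ (b ≤ᵇ b') ∧ (if t <L t' then (ℤ.suc b ≤ᵇ b') else true)
  ∧ compatible (t' ∷ ts) (b' ∷ bs)
compatible _             _             = false

slide : CWord → PS
slide t b = if compatible t b then 1ℚ else 0ℚ

φ : 𝒬 → PS
φ a m = sumℚ (map (λ { (c , t) → c ℚ.* slide t m }) a)

maxRow : CWord → List ℤ
maxRow []            = []
maxRow (t ∷ [])      = val t ∷ []
maxRow (t ∷ t' ∷ ts) with maxRow (t' ∷ ts)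
... | []    = []   -- unreachable
... | h ∷ r = (if t <L t' then (val t ℤ.⊓ (h ℤ.- ℤ.1ℤ)) else h) ∷ h ∷ r

_≡m_ : CWord → CWord → Set
p ≡m q = maxRow p ≡ maxRow q

-- exponent sequence (flattening) of a sorted monomial: run lengths
runs : List ℤ → List ℕ
runs []      = []
runs (x ∷ m) with runs m | m
... | r       | []     = 1 ∷ r
... | []      | _ ∷ _  = 1 ∷ []   -- unreachable
... | n ∷ r   | y ∷ _  = if (x ≤ᵇ y) ∧ (y ≤ᵇ x) then suc n ∷ r else 1 ∷ n ∷ r

low high : ℤ → List ℤ → List ℤ
low  M m = filter (λ i → i ℤ.≤? M) m
high M m = filter (λ i → ℤ.suc M ℤ.≤? i) m

BoundedDegree : PS → Set
BoundedDegree f = ∃[ d ] ∀ m → Sorted m → d ℕ.< length m → f m ≡ 0ℚ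

SupportBoundedAbove : PS → Set
SupportBoundedAbove f = ∃[ N ] ∀ m → Sorted m → ¬ (f m ≡ 0ℚ) → All (ℤ._≤ N) m

QuasisymmetricBelow : ℤ → PS → Set
QuasisymmetricBelow M f = ∀ m m' → Sorted m → Sorted m' →
  high M m ≡ high M m' → runs (low M m) ≡ runs (low M m') → f m ≡ f m'

BackQSym : PS → Set
BackQSym f = BoundedDegree f × SupportBoundedAbove f × (∃[ M ] QuasisymmetricBelow M f)

{-# OPTIONS --safe #-}
-- Multiplicativity is
-- a shuffle rule for compatible sequences: since the colours of q ↑ maxcol p avoid those of p, the letters
-- of p and of the shifted q are distinct, and a bottom row of a shuffle splits into bottom rows of p and
-- of q; for each factorisation of a monomial this is a bijection, proved by counting column by column.
-- Compatibility with t only depends on the maximal bottom row m(t), which puts every p − q with p ≡ q in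
-- the kernel. Conversely the slide polynomial of the monochrome word on a sorted r contains x_r and
-- otherwise only monomials below r, so in a kernel element the coefficients of each ≡-class add up to 0.
-- The image is back-quasisymmetric because a has finitely many letters. For surjectivity, let x_N be the
-- top variable above the quasisymmetry bound, write f = remainder + x_N · quotient with x_N = 𝔉_N − 𝔉_(N−1),
-- and recurse; once no such variable is left, f is quasisymmetric and is expanded by Möbius inversion
-- in the fundamental quasisymmetric functions, which are slide polynomials of words of constant value.
module Submission where

open import Defs
open import Data.Product using (Σ; ∃; ∃-syntax; _×_; _,_; proj₁; proj₂; map₁; map₂)
open import Data.List using (List; []; _∷_; map; foldr; _++_; concatMap; length; deduplicate; filter)
open import Data.List.Relation.Unary.All using (All; []; _∷_)
open import Data.Rational using (ℚ; 0ℚ; 1ℚ; _+_; _*_; -_; _-_)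
open import Function.Bundles using (_⇔_; mk⇔; Equivalence)
open import Relation.Binary.PropositionalEquality using (_≡_; _≢_; refl; sym; trans; cong; cong₂; subst; module ≡-Reasoning)

open import Algebra.Solver.Ring.AlmostCommutativeRing using (fromCommutativeRing)
import Algebra.Solver.Ring.Simple as RingSolver
open import Data.Bool using (Bool; true; false; if_then_else_; _∧_)
import Data.Bool.Properties as Boolₚ
open import Data.Empty using (⊥-elim)
open import Data.Integer as ℤ using (ℤ; _≤ᵇ_)
import Data.Integer.Properties as ℤₚ
import Data.List.Extrema
import Data.List.Properties as Listₚ
open import Data.List.Membership.Propositional using (_∈_; _∉_)
import Data.List.Membership.Propositional.Properties as ∈ₚ
open import Data.List.Membership.DecPropositional ℤ._≟_ using (_∈?_)
open import Data.List.Relation.Binary.Disjoint.Propositional using (Disjoint; contractₗ; contractᵣ)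
import Data.List.Relation.Binary.Permutation.Propositional.Properties as Permₚ
open import Data.List.Relation.Binary.Pointwise as Pointwise using (Pointwise; []; _∷_)
import Data.List.Relation.Unary.All as All
import Data.List.Relation.Unary.All.Properties as Allₚ
open import Data.List.Relation.Unary.AllPairs using ([]; _∷_)
open import Data.List.Relation.Unary.Any using (Any; here; there)
import Data.List.Relation.Unary.Any as Any
open import Data.List.Relation.Unary.Linked using ([]; [-]; _∷_)
import Data.List.Relation.Unary.Linked as Linked
import Data.List.Relation.Unary.Linked.Properties as Linkedₚ
open import Data.List.Relation.Unary.Unique.Propositional using (Unique)
open import Data.List.Relation.Unary.Unique.DecPropositional.Properties using (deduplicate-!)
open import Data.List.Sort.InsertionSort.Base ℤₚ.≤-decTotalOrder using (insert)
open import Data.List.Sort.InsertionSort.Properties ℤₚ.≤-decTotalOrder using (insert-↗; insert-↭)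
open import Data.Maybe using (Maybe; just; nothing)
open import Data.Nat as ℕ using (ℕ; zero; suc)
open import Data.Nat.Induction using (<-wellFounded)
import Data.Nat.Properties as ℕₚ
import Data.Product.Properties as ×ₚ
import Data.Rational.Properties as ℚₚ
open import Data.Sum using (_⊎_; inj₁; inj₂)
import Induction.WellFounded as WF
open import Level using (0ℓ)
open import Relation.Binary.Definitions using (DecidableEquality; tri<; tri≈; tri>)
import Relation.Binary.Construct.On as On
open import Relation.Nullary using (¬_; Dec; yes; no; ¬?; _×-dec_)
open import Relation.Nullary.Decidable using (⌊_⌋; isYes≗does; dec-true; dec-false)
import Relation.Unary as U

module ℚ-Solver = RingSolver (fromCommutativeRing ℚₚ.+-*-commutativeRing) ℚₚ._≟_
open ℚ-Solver using (solve; _:=_; _:+_; _:-_; _:*_; :-_; con)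

⌊⌋-true : {P : Set} (d : Dec P) → P → ⌊ d ⌋ ≡ true
⌊⌋-true d p = trans (isYes≗does d) (dec-true d p)

⌊⌋-false : {P : Set} (d : Dec P) → ¬ P → ⌊ d ⌋ ≡ false
⌊⌋-false d ¬p = trans (isYes≗does d) (dec-false d ¬p)

¬true⇒false : ∀ {b} → b ≢ true → b ≡ false
¬true⇒false = Boolₚ.¬-not

¬false⇒true : ∀ {b} → b ≢ false → b ≡ true
¬false⇒true = Boolₚ.¬-not

Bool-ext : ∀ {b c} → (b ≡ true → c ≡ true) → (c ≡ true → b ≡ true) → b ≡ c
Bool-ext b⇒c c⇒b = Boolₚ.⇔→≡ (mk⇔ b⇒c c⇒b)

∧-trueˡ : ∀ {b c} → (b ∧ c) ≡ true → b ≡ true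
∧-trueˡ {true} _ = refl

∧-trueʳ : ∀ {b c} → (b ∧ c) ≡ true → c ≡ true
∧-trueʳ {true} e = e

∧-true : ∀ {b c} → b ≡ true → c ≡ true → (b ∧ c) ≡ true
∧-true refl refl = refl

≤ᵇ-complete : ∀ {i j} → i ℤ.≤ j → (i ≤ᵇ j) ≡ true
≤ᵇ-complete i≤j = Equivalence.to Boolₚ.T-≡ (ℤₚ.≤⇒≤ᵇ i≤j)

≤ᵇ-sound : ∀ {i j} → (i ≤ᵇ j) ≡ true → i ℤ.≤ j
≤ᵇ-sound e = ℤₚ.≤ᵇ⇒≤ (Equivalence.from Boolₚ.T-≡ e)

≤ᵇ-false : ∀ {i j} → ¬ (i ℤ.≤ j) → (i ≤ᵇ j) ≡ false
≤ᵇ-false i≰j = ¬true⇒false (λ e → i≰j (≤ᵇ-sound e))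

≤ᵇ-refl : ∀ x → (x ≤ᵇ x) ≡ true
≤ᵇ-refl x = ≤ᵇ-complete (ℤₚ.≤-refl {x})

suc-≤ᵇ-false : ∀ x → (ℤ.suc x ≤ᵇ x) ≡ false
suc-≤ᵇ-false x = ≤ᵇ-false {ℤ.suc x} (λ sx≤x → ℤₚ.<-irrefl refl (ℤₚ.suc[i]≤j⇒i<j sx≤x))

∑ : {A : Set} → List A → (A → ℚ) → ℚ
∑ xs f = sumℚ (map f xs)

𝟙 : Bool → ℚ
𝟙 b = if b then 1ℚ else 0ℚ

𝟙-∧ : ∀ b c → 𝟙 (b ∧ c) ≡ 𝟙 b * 𝟙 c
𝟙-∧ true c = sym (ℚₚ.*-identityˡ (𝟙 c))
𝟙-∧ false c = sym (ℚₚ.*-zeroˡ (𝟙 c))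

∑-++ : {A : Set} (xs ys : List A) (f : A → ℚ) → ∑ (xs ++ ys) f ≡ ∑ xs f + ∑ ys f
∑-++ [] ys f = sym (ℚₚ.+-identityˡ _)
∑-++ (x ∷ xs) ys f = trans (cong (f x +_) (∑-++ xs ys f)) (sym (ℚₚ.+-assoc (f x) _ _))

∑-cong-∈ : {A : Set} (xs : List A) {f g : A → ℚ} → (∀ {x} → x ∈ xs → f x ≡ g x) → ∑ xs f ≡ ∑ xs g
∑-cong-∈ [] _ = refl
∑-cong-∈ (x ∷ xs) f≗g = cong₂ _+_ (f≗g (here refl)) (∑-cong-∈ xs (λ x∈ → f≗g (there x∈)))

∑-cong : {A : Set} (xs : List A) {f g : A → ℚ} → (∀ x → f x ≡ g x) → ∑ xs f ≡ ∑ xs g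
∑-cong xs f≗g = ∑-cong-∈ xs (λ {x} _ → f≗g x)

∑-zero : {A : Set} (xs : List A) {f : A → ℚ} → (∀ {x} → x ∈ xs → f x ≡ 0ℚ) → ∑ xs f ≡ 0ℚ
∑-zero [] _ = refl
∑-zero (x ∷ xs) f≗0 = cong₂ _+_ (f≗0 (here refl)) (∑-zero xs (λ x∈ → f≗0 (there x∈)))

∑-+ : {A : Set} (xs : List A) (f g : A → ℚ) → ∑ xs (λ x → f x + g x) ≡ ∑ xs f + ∑ xs g
∑-+ [] f g = refl
∑-+ (x ∷ xs) f g = trans (cong (f x + g x +_) (∑-+ xs f g))
  (solve 4 (λ a b c d → (a :+ b) :+ (c :+ d) := (a :+ c) :+ (b :+ d)) refl (f x) (g x) (∑ xs f) (∑ xs g))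

∑-*ˡ : {A : Set} (c : ℚ) (xs : List A) (f : A → ℚ) → ∑ xs (λ x → c * f x) ≡ c * ∑ xs f
∑-*ˡ c [] f = sym (ℚₚ.*-zeroʳ c)
∑-*ˡ c (x ∷ xs) f = trans (cong (c * f x +_) (∑-*ˡ c xs f)) (sym (ℚₚ.*-distribˡ-+ c (f x) _))

∑-*ʳ : {A : Set} (c : ℚ) (xs : List A) (f : A → ℚ) → ∑ xs (λ x → f x * c) ≡ ∑ xs f * c
∑-*ʳ c xs f = trans (∑-cong xs (λ x → ℚₚ.*-comm (f x) c)) (trans (∑-*ˡ c xs f) (ℚₚ.*-comm c _))

∑-neg : {A : Set} (xs : List A) (f : A → ℚ) → ∑ xs (λ x → - f x) ≡ - ∑ xs f
∑-neg [] f = refl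
∑-neg (x ∷ xs) f = trans (cong (- f x +_) (∑-neg xs f)) (sym (ℚₚ.neg-distrib-+ (f x) _))

∑-map : {A B : Set} (g : A → B) (xs : List A) (f : B → ℚ) → ∑ (map g xs) f ≡ ∑ xs (λ x → f (g x))
∑-map g [] f = refl
∑-map g (x ∷ xs) f = cong (f (g x) +_) (∑-map g xs f)

∑-concatMap : {A B : Set} (g : A → List B) (xs : List A) (f : B → ℚ) →
  ∑ (concatMap g xs) f ≡ ∑ xs (λ x → ∑ (g x) f)
∑-concatMap g [] f = refl
∑-concatMap g (x ∷ xs) f = trans (∑-++ (g x) (concatMap g xs) f) (cong (∑ (g x) f +_) (∑-concatMap g xs f))

∑-comm : {A B : Set} (xs : List A) (ys : List B) (f : A → B → ℚ) →
  ∑ xs (λ x → ∑ ys (f x)) ≡ ∑ ys (λ y → ∑ xs (λ x → f x y))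
∑-comm [] ys f = sym (∑-zero ys (λ _ → refl))
∑-comm (x ∷ xs) ys f = trans (cong (∑ ys (f x) +_) (∑-comm xs ys f)) (sym (∑-+ ys (f x) _))

module Grouping {K : Set} (_≟_ : DecidableEquality K) where

  ∑-≟-∉ : (ks : List K) (k₀ : K) → k₀ ∉ ks → (c : ℚ) → ∑ ks (λ k → if ⌊ k₀ ≟ k ⌋ then c else 0ℚ) ≡ 0ℚ
  ∑-≟-∉ [] k₀ _ c = refl
  ∑-≟-∉ (k ∷ ks) k₀ k₀∉ c with k₀ ≟ k
  ... | yes k₀≡k = ⊥-elim (k₀∉ (here k₀≡k))
  ... | no _ = trans (ℚₚ.+-identityˡ _) (∑-≟-∉ ks k₀ (λ k₀∈ → k₀∉ (there k₀∈)) c)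

  ∑-≟-∈ : (ks : List K) → Unique ks → (k₀ : K) → k₀ ∈ ks → (c : ℚ) →
    ∑ ks (λ k → if ⌊ k₀ ≟ k ⌋ then c else 0ℚ) ≡ c
  ∑-≟-∈ (k ∷ ks) (k∉ks ∷ uks) k₀ k₀∈ c with k₀ ≟ k
  ... | yes refl = trans (cong (c +_) (∑-≟-∉ ks k₀ (λ k₀∈ks → All.lookup k∉ks k₀∈ks refl) c)) (ℚₚ.+-identityʳ c)
  ... | no k₀≢k with k₀∈
  ...   | here k₀≡k = ⊥-elim (k₀≢k k₀≡k)
  ...   | there k₀∈ks = trans (ℚₚ.+-identityˡ _) (∑-≟-∈ ks uks k₀ k₀∈ks c)

  ∑-fibres : {E : Set} (key : E → K) (es : List E) (h : E → ℚ) (ks : List K) → Unique ks →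
    (∀ {e} → e ∈ es → key e ∈ ks) →
    ∑ es h ≡ ∑ ks (λ k → ∑ es (λ e → if ⌊ key e ≟ k ⌋ then h e else 0ℚ))
  ∑-fibres key es h ks uks cover =
    sym (trans (∑-comm ks es _) (∑-cong-∈ es (λ {e} e∈ → ∑-≟-∈ ks uks (key e) (cover e∈) (h e))))

  ∑-group : {E : Set} (key : E → K) (c : E → ℚ) (g : K → ℚ) (es : List E) (ks : List K) → Unique ks →
    (∀ {e} → e ∈ es → key e ∈ ks) →
    ∑ es (λ e → c e * g (key e)) ≡ ∑ ks (λ k → ∑ es (λ e → if ⌊ key e ≟ k ⌋ then c e else 0ℚ) * g k)
  ∑-group key c g es ks uks cover = trans (∑-fibres key es _ ks uks cover)
    (∑-cong ks (λ k → trans (∑-cong es (λ e → restrict e k)) (∑-*ʳ (g k) es _)))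
    where
    restrict : ∀ e k → (if ⌊ key e ≟ k ⌋ then c e * g (key e) else 0ℚ) ≡ (if ⌊ key e ≟ k ⌋ then c e else 0ℚ) * g k
    restrict e k with key e ≟ k
    ... | yes refl = refl
    ... | no _ = sym (ℚₚ.*-zeroˡ (g k))

  keys : {E : Set} → (E → K) → List E → List K
  keys key es = deduplicate _≟_ (map key es)

  keys-unique : {E : Set} (key : E → K) (es : List E) → Unique (keys key es)
  keys-unique key es = deduplicate-! _≟_ (map key es)

  ∈-keys⁺ : {E : Set} (key : E → K) (es : List E) → ∀ {e} → e ∈ es → key e ∈ keys key es
  ∈-keys⁺ key es e∈ = ∈ₚ.∈-deduplicate⁺ _≟_ (∈ₚ.∈-map⁺ key e∈)

  ∈-keys⁻ : {E : Set} (key : E → K) (es : List E) → ∀ {k} → k ∈ keys key es → k ∈ map key es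
  ∈-keys⁻ key es k∈ = ∈ₚ.∈-deduplicate⁻ _≟_ (map key es) k∈

_≟ᵂ_ : DecidableEquality CWord
_≟ᵂ_ = Listₚ.≡-dec (×ₚ.≡-dec ℤ._≟_ ℕ._≟_)

open Grouping _≟ᵂ_ using () renaming (∑-group to ∑-group-words; keys to wordKeys;
  keys-unique to wordKeys-unique; ∈-keys⁺ to ∈-wordKeys⁺)

φ-+ : ∀ a b m → φ (a +𝒬 b) m ≡ φ a m + φ b m
φ-+ a b m = ∑-++ a b _

φ-· : ∀ c a m → φ (c ·𝒬 a) m ≡ c * φ a m
φ-· c a m = trans (∑-map _ a _) (trans (∑-cong a (λ e → ℚₚ.*-assoc c (proj₁ e) _)) (∑-*ˡ c a _))

φ-1 : ∀ m → φ 1𝒬 m ≡ 1PS m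
φ-1 [] = refl
φ-1 (_ ∷ _) = refl

φ-via-coeff𝒬 : ∀ a m (ws : List CWord) → Unique ws → (∀ {e} → e ∈ a → proj₂ e ∈ ws) →
  φ a m ≡ ∑ ws (λ w → coeff𝒬 a w * slide w m)
φ-via-coeff𝒬 a m ws uws cover = ∑-group-words proj₂ proj₁ (λ w → slide w m) a ws uws cover

φ-resp-≈𝒬 : ∀ a b → a ≈𝒬 b → ∀ m → φ a m ≡ φ b m
φ-resp-≈𝒬 a b a≈b m = begin
  φ a m                                ≡⟨ φ-via-coeff𝒬 a m ws ws-unique (λ e∈ → covers (∈ₚ.∈-++⁺ˡ e∈)) ⟩
  ∑ ws (λ w → coeff𝒬 a w * slide w m) ≡⟨ ∑-cong ws (λ w → cong (_* slide w m) (a≈b w)) ⟩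
  ∑ ws (λ w → coeff𝒬 b w * slide w m) ≡⟨ φ-via-coeff𝒬 b m ws ws-unique (λ e∈ → covers (∈ₚ.∈-++⁺ʳ a e∈)) ⟨
  φ b m                                ∎
  where
  open ≡-Reasoning
  ws = wordKeys proj₂ (a ++ b)
  ws-unique = wordKeys-unique proj₂ (a ++ b)
  covers : ∀ {e} → e ∈ a ++ b → proj₂ e ∈ ws
  covers = ∈-wordKeys⁺ proj₂ (a ++ b)

-- Letters and compatible sequences

_≺_ : Letter → Letter → Set
(i , k) ≺ (i' , k') = i ℤ.< i' ⊎ (i ≡ i' × k ℕ.< k')

<L⇒≺ : ∀ l l' → l <L l' ≡ true → l ≺ l'
<L⇒≺ (i , k) (i' , k') e with ℤ.suc i ≤ᵇ i' in e₁
... | true = inj₁ (ℤₚ.suc[i]≤j⇒i<j (≤ᵇ-sound e₁))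
... | false = inj₂ ( ℤₚ.≤-antisym (≤ᵇ-sound (∧-trueˡ e)) (≤ᵇ-sound (∧-trueˡ i'≤i∧k<k'))
                   , ℕₚ.≤ᵇ⇒≤ (suc k) k' (Equivalence.from Boolₚ.T-≡ (∧-trueʳ i'≤i∧k<k')))
  where
  i'≤i∧k<k' : (i' ≤ᵇ i) ∧ (suc k ℕ.≤ᵇ k') ≡ true
  i'≤i∧k<k' = ∧-trueʳ {i ≤ᵇ i'} e

≺⇒<L : ∀ l l' → l ≺ l' → l <L l' ≡ true
≺⇒<L (i , k) (i' , k') (inj₁ i<i') rewrite ≤ᵇ-complete (ℤₚ.i<j⇒suc[i]≤j i<i') = refl
≺⇒<L (i , k) (i , k') (inj₂ (refl , k<k'))
  rewrite ≤ᵇ-complete (ℤₚ.≤-refl {i}) | Equivalence.to Boolₚ.T-≡ (ℕₚ.≤⇒≤ᵇ k<k') = Boolₚ.∨-zeroʳ _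

≺-trans : ∀ {l₁ l₂ l₃} → l₁ ≺ l₂ → l₂ ≺ l₃ → l₁ ≺ l₃
≺-trans (inj₁ p) (inj₁ q) = inj₁ (ℤₚ.<-trans p q)
≺-trans (inj₁ p) (inj₂ (refl , _)) = inj₁ p
≺-trans (inj₂ (refl , _)) (inj₁ q) = inj₁ q
≺-trans (inj₂ (refl , p)) (inj₂ (refl , q)) = inj₂ (refl , ℕₚ.<-trans p q)

≺-asym : ∀ {l l'} → l ≺ l' → ¬ l' ≺ l
≺-asym (inj₁ p) (inj₁ q) = ℤₚ.<-asym p q
≺-asym (inj₁ p) (inj₂ (refl , _)) = ℤₚ.<-irrefl refl p
≺-asym (inj₂ (refl , _)) (inj₁ q) = ℤₚ.<-irrefl refl q
≺-asym (inj₂ (refl , p)) (inj₂ (_ , q)) = ℕₚ.<-asym p q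

≺-connex : ∀ l l' → l ≢ l' → l ≺ l' ⊎ l' ≺ l
≺-connex (i , k) (j , l) l≢l' with ℤₚ.<-cmp i j
... | tri< i<j _ _ = inj₁ (inj₁ i<j)
... | tri> _ _ j<i = inj₂ (inj₁ j<i)
... | tri≈ _ refl _ with ℕₚ.<-cmp k l
...   | tri< k<l _ _ = inj₁ (inj₂ (refl , k<l))
...   | tri> _ _ l<k = inj₂ (inj₂ (refl , l<k))
...   | tri≈ _ refl _ = ⊥-elim (l≢l' refl)

<L-trans : ∀ l₁ l₂ l₃ → l₁ <L l₂ ≡ true → l₂ <L l₃ ≡ true → l₁ <L l₃ ≡ true
<L-trans l₁ l₂ l₃ p q = ≺⇒<L l₁ l₃ (≺-trans (<L⇒≺ l₁ l₂ p) (<L⇒≺ l₂ l₃ q))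

<L-asym : ∀ l l' → l <L l' ≡ true → l' <L l ≡ false
<L-asym l l' p = ¬true⇒false (λ q → ≺-asym (<L⇒≺ l l' p) (<L⇒≺ l' l q))

<L-irrefl : ∀ l → l <L l ≡ false
<L-irrefl l = ¬true⇒false (λ p → ≺-asym (<L⇒≺ l l p) (<L⇒≺ l l p))

<L-connex : ∀ l l' → l ≢ l' → l <L l' ≡ true ⊎ l' <L l ≡ true
<L-connex l l' l≢l' with ≺-connex l l' l≢l'
... | inj₁ p = inj₁ (≺⇒<L l l' p)
... | inj₂ p = inj₂ (≺⇒<L l' l p)

<L-val : ∀ l l' → val l ℤ.< val l' → l <L l' ≡ true
<L-val l l' p = ≺⇒<L l l' (inj₁ p)

¬<L⇒val≥ : ∀ l l' → l <L l' ≡ false → val l' ℤ.≤ val l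
¬<L⇒val≥ l l' e = ℤₚ.≮⇒≥ (λ p → Boolₚ.not-¬ (<L-val l l' p) e)

shift : ℕ → Letter → Letter
shift a (i , k) = (i , k ℕ.+ a)

<L-shift : ∀ a l l' → shift a l <L shift a l' ≡ l <L l'
<L-shift a l l' = Bool-ext
  (λ p → ≺⇒<L l l' (unshift l l' (<L⇒≺ (shift a l) (shift a l') p)))
  (λ p → ≺⇒<L (shift a l) (shift a l') (reshift l l' (<L⇒≺ l l' p)))
  where
  reshift : ∀ l l' → l ≺ l' → shift a l ≺ shift a l'
  reshift _ _ (inj₁ p) = inj₁ p
  reshift _ _ (inj₂ (refl , p)) = inj₂ (refl , ℕₚ.+-monoˡ-< a p)
  unshift : ∀ l l' → shift a l ≺ shift a l' → l ≺ l'
  unshift _ _ (inj₁ p) = inj₁ p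
  unshift (_ , k) (_ , k') (inj₂ (refl , p)) = inj₂ (refl , ℕₚ.+-cancelʳ-< a k k' p)

Prev : Set
Prev = Maybe (Letter × ℤ)

-- `compatible` read as an automaton whose state is the previous column (top letter, bottom entry).
admits : Prev → Letter → ℤ → Bool
admits nothing t b = b ≤ᵇ val t
admits (just (ℓ , y)) t b = (y ≤ᵇ b) ∧ ((if ℓ <L t then ℤ.suc y ≤ᵇ b else true) ∧ (b ≤ᵇ val t))

compatibleAfter : Prev → CWord → List ℤ → Bool
compatibleAfter s [] [] = true
compatibleAfter s [] (_ ∷ _) = false
compatibleAfter s (_ ∷ _) [] = false
compatibleAfter s (t ∷ ts) (b ∷ bs) = admits s t b ∧ compatibleAfter (just (t , b)) ts bs

compatible-∷ : ∀ t b ts bs → compatible (t ∷ ts) (b ∷ bs) ≡ (b ≤ᵇ val t) ∧ compatibleAfter (just (t , b)) ts bs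
compatible-∷ t b [] [] = sym (Boolₚ.∧-identityʳ _)
compatible-∷ t b [] (_ ∷ _) = sym (Boolₚ.∧-zeroʳ _)
compatible-∷ t b (_ ∷ _) [] = sym (Boolₚ.∧-zeroʳ _)
compatible-∷ t b (t' ∷ ts) (b' ∷ bs) rewrite compatible-∷ t' b' ts bs =
  cong ((b ≤ᵇ val t) ∧_) (sym (trans (Boolₚ.∧-assoc x (y ∧ z) w) (cong (x ∧_) (Boolₚ.∧-assoc y z w))))
  where
  x = b ≤ᵇ b'
  y = if t <L t' then ℤ.suc b ≤ᵇ b' else true
  z = b' ≤ᵇ val t'
  w = compatibleAfter (just (t' , b')) ts bs

compatible≡compatibleAfter : ∀ t b → compatible t b ≡ compatibleAfter nothing t b
compatible≡compatibleAfter [] [] = refl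
compatible≡compatibleAfter [] (_ ∷ _) = refl
compatible≡compatibleAfter (_ ∷ []) [] = refl
compatible≡compatibleAfter (_ ∷ _ ∷ _) [] = refl
compatible≡compatibleAfter (t ∷ ts) (b ∷ bs) = compatible-∷ t b ts bs

slide≡𝟙 : ∀ t b → slide t b ≡ 𝟙 (compatibleAfter nothing t b)
slide≡𝟙 t b = cong 𝟙 (compatible≡compatibleAfter t b)

shiftPrev : ℕ → Prev → Prev
shiftPrev a nothing = nothing
shiftPrev a (just (ℓ , y)) = just (shift a ℓ , y)

compatibleAfter-shift : ∀ a s t b → compatibleAfter (shiftPrev a s) (map (shift a) t) b ≡ compatibleAfter s t b
compatibleAfter-shift a s [] [] = refl
compatibleAfter-shift a s [] (_ ∷ _) = refl
compatibleAfter-shift a s (_ ∷ _) [] = refl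
compatibleAfter-shift a s (t ∷ ts) (b ∷ bs) =
  cong₂ _∧_ (admits-shift s) (compatibleAfter-shift a (just (t , b)) ts bs)
  where
  admits-shift : ∀ s → admits (shiftPrev a s) (shift a t) b ≡ admits s t b
  admits-shift nothing = refl
  admits-shift (just (ℓ , y)) rewrite <L-shift a ℓ t = refl

admits⇒≤val : ∀ s t b → admits s t b ≡ true → (b ≤ᵇ val t) ≡ true
admits⇒≤val nothing t b e = e
admits⇒≤val (just (ℓ , y)) t b e = ∧-trueʳ {if ℓ <L t then ℤ.suc y ≤ᵇ b else true} (∧-trueʳ {y ≤ᵇ b} e)

compatibleAfter⇒length : ∀ s t b → compatibleAfter s t b ≡ true → length t ≡ length b
compatibleAfter⇒length s [] [] e = refl
compatibleAfter⇒length s (t ∷ ts) (b ∷ bs) e = cong suc (compatibleAfter⇒length (just (t , b)) ts bs (∧-trueʳ e))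

compatibleAfter⇒≤vals : ∀ s t b → compatibleAfter s t b ≡ true → Pointwise ℤ._≤_ b (map val t)
compatibleAfter⇒≤vals s [] [] e = []
compatibleAfter⇒≤vals s (t ∷ ts) (b ∷ bs) e =
  ≤ᵇ-sound (admits⇒≤val s t b (∧-trueˡ e)) ∷ compatibleAfter⇒≤vals (just (t , b)) ts bs (∧-trueʳ e)

data Split : List ℤ → List ℤ → List ℤ → Set where
  [] : Split [] [] []
  _∷ˡ_ : ∀ x {m u v} → Split m u v → Split (x ∷ m) (x ∷ u) v
  _∷ʳ_ : ∀ x {m u v} → Split m u v → Split (x ∷ m) u (x ∷ v)

Split-sym : ∀ {m u v} → Split m u v → Split m v u
Split-sym [] = []
Split-sym (x ∷ˡ s) = x ∷ʳ Split-sym s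
Split-sym (x ∷ʳ s) = x ∷ˡ Split-sym s

Split-[]ˡ : ∀ {m v} → Split m [] v → v ≡ m
Split-[]ˡ [] = refl
Split-[]ˡ (x ∷ʳ s) = cong (x ∷_) (Split-[]ˡ s)

Split-[]ʳ : ∀ {m u} → Split m u [] → u ≡ m
Split-[]ʳ s = Split-[]ˡ (Split-sym s)

Split-allˡ : ∀ m → Split m m []
Split-allˡ [] = []
Split-allˡ (x ∷ m) = x ∷ˡ Split-allˡ m

Split-allʳ : ∀ m → Split m [] m
Split-allʳ m = Split-sym (Split-allˡ m)

Split-⊆ʳ : ∀ {m u v} → Split m u v → ∀ {y} → y ∈ v → y ∈ m
Split-⊆ʳ (x ∷ˡ s) y∈ = there (Split-⊆ʳ s y∈)
Split-⊆ʳ (x ∷ʳ s) (here refl) = here refl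
Split-⊆ʳ (x ∷ʳ s) (there y∈) = there (Split-⊆ʳ s y∈)

Split-⊆ˡ : ∀ {m u v} → Split m u v → ∀ {y} → y ∈ u → y ∈ m
Split-⊆ˡ s = Split-⊆ʳ (Split-sym s)

Sorted-head≤ : ∀ {x m} → Sorted (x ∷ m) → All (x ℤ.≤_) m
Sorted-head≤ s = All.tail (Linkedₚ.Linked⇒All ℤₚ.≤-trans ℤₚ.≤-refl s)

Sorted-∈ : ∀ {x m y} → Sorted (x ∷ m) → y ∈ m → x ℤ.≤ y
Sorted-∈ s = All.lookup (Sorted-head≤ s)

∷-sorted : ∀ {x v} → All (x ℤ.≤_) v → Sorted v → Sorted (x ∷ v)
∷-sorted [] _ = [-]
∷-sorted (x≤y ∷ _) sv = x≤y ∷ sv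

Split-sortedʳ : ∀ {m u v} → Split m u v → Sorted m → Sorted v
Split-sortedʳ [] _ = []
Split-sortedʳ (x ∷ˡ s) sm = Split-sortedʳ s (Linked.tail sm)
Split-sortedʳ (x ∷ʳ s) sm =
  ∷-sorted (All.tabulate (λ y∈ → Sorted-∈ sm (Split-⊆ʳ s y∈))) (Split-sortedʳ s (Linked.tail sm))

Split-swap : ∀ {x m u v} → Sorted (x ∷ m) → Split m u (x ∷ v) → Split m (x ∷ u) v
Split-swap _ (x ∷ʳ s) = x ∷ˡ s
Split-swap {x} sm (y ∷ˡ s) with ℤₚ.≤-antisym (Sorted-∈ sm (here refl)) (Sorted-∈ (Linked.tail sm) (Split-⊆ʳ s (here refl)))
... | refl = x ∷ˡ Split-swap (Linked.tail sm) s

splits→Split : ∀ m {u v} → (u , v) ∈ splits m → Split m u v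
splits→Split [] (here refl) = []
splits→Split (x ∷ m) uv∈ = extend (splits m) (splits→Split m) (∈ₚ.∈-concatMap⁻ _ {xs = splits m} uv∈)
  where
  extend : ∀ L → (∀ {u v} → (u , v) ∈ L → Split m u v) → ∀ {u v} →
    Any (λ e → (u , v) ∈ (x ∷ proj₁ e , proj₂ e) ∷ (proj₁ e , x ∷ proj₂ e) ∷ []) L → Split (x ∷ m) u v
  extend (_ ∷ L) ih (here (here refl)) = x ∷ˡ ih (here refl)
  extend (_ ∷ L) ih (here (there (here refl))) = x ∷ʳ ih (here refl)
  extend (_ ∷ L) ih (there e∈) = extend L (λ uv∈L → ih (there uv∈L)) e∈

Split→splits : ∀ {m u v} → Split m u v → (u , v) ∈ splits m
Split→splits [] = here refl
Split→splits {x ∷ m} (x ∷ˡ s) = ∈ₚ.∈-concatMap⁺ _ {xs = splits m} (Any.map (λ { refl → here refl }) (Split→splits s))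
Split→splits {x ∷ m} (x ∷ʳ s) = ∈ₚ.∈-concatMap⁺ _ {xs = splits m} (Any.map (λ { refl → there (here refl) }) (Split→splits s))

_≟ᴾ_ : DecidableEquality (List ℤ × List ℤ)
_≟ᴾ_ = ×ₚ.≡-dec (Listₚ.≡-dec ℤ._≟_) (Listₚ.≡-dec ℤ._≟_)

factorisations-unique : ∀ m → Unique (factorisations m)
factorisations-unique m = deduplicate-! _≟ᴾ_ (splits m)

factorisations→Split : ∀ m {u v} → (u , v) ∈ factorisations m → Split m u v
factorisations→Split m uv∈ = splits→Split m (∈ₚ.∈-deduplicate⁻ _≟ᴾ_ (splits m) uv∈)

Split→factorisations : ∀ {m u v} → Split m u v → (u , v) ∈ factorisations m
Split→factorisations s = ∈ₚ.∈-deduplicate⁺ _≟ᴾ_ (Split→splits s)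

-- Multiplicativity

∧∧-true : ∀ {u v} w → u ≡ true → v ≡ true → (u ∧ (v ∧ w)) ≡ w
∧∧-true _ refl refl = refl

if-true : ∀ c {d} → (c ≡ true → d ≡ true) → (if c then d else true) ≡ true
if-true true d = d refl
if-true false _ = refl

if-true-elim : ∀ {c d} → c ≡ true → (if c then d else true) ≡ true → d ≡ true
if-true-elim refl e = e

admits-above : ∀ ℓ z b y → z ℤ.< y → admits (just (ℓ , z)) b y ≡ (y ≤ᵇ val b)
admits-above ℓ z b y z<y =
  ∧∧-true (y ≤ᵇ val b) (≤ᵇ-complete (ℤₚ.<⇒≤ z<y)) (if-true (ℓ <L b) (λ _ → ≤ᵇ-complete (ℤₚ.i<j⇒suc[i]≤j z<y)))

admits-above-admitted : ∀ s a b x y → x ℤ.< y → admits s a x ≡ true → admits s b y ≡ (y ≤ᵇ val b)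
admits-above-admitted nothing a b x y _ _ = refl
admits-above-admitted (just (ℓ , z)) a b x y x<y h = admits-above ℓ z b y (ℤₚ.≤-<-trans (≤ᵇ-sound (∧-trueˡ h)) x<y)

admits-after-smaller : ∀ s a b x y → x ℤ.< y → admits s a x ≡ true → admits (just (a , x)) b y ≡ admits s b y
admits-after-smaller s a b x y x<y h =
  trans (admits-above a x b y x<y) (sym (admits-above-admitted s a b x y x<y h))

admits-same-entry : ∀ a x b → admits (just (a , x)) b x ≡ (if a <L b then false else (x ≤ᵇ val b))
admits-same-entry a x b
  rewrite ≤ᵇ-refl x | suc-≤ᵇ-false x
  with a <L b
... | true = refl
... | false = refl

admits-smaller-letter : ∀ s a b x → b <L a ≡ true → admits s a x ≡ true → admits s b x ≡ (x ≤ᵇ val b)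
admits-smaller-letter nothing a b x _ _ = refl
admits-smaller-letter (just (ℓ , y)) a b x b<a h = ∧∧-true (x ≤ᵇ val b) (∧-trueˡ {y ≤ᵇ x} h)
  (if-true (ℓ <L b) (λ ℓ<b → if-true-elim (<L-trans ℓ b a ℓ<b b<a) (∧-trueˡ (∧-trueʳ {y ≤ᵇ x} h))))

compatibleAfter-skip : ∀ s a x b q V → (∀ {y V'} → V ≡ y ∷ V' → x ℤ.< y) → admits s a x ≡ true →
  compatibleAfter (just (a , x)) (b ∷ q) V ≡ compatibleAfter s (b ∷ q) V
compatibleAfter-skip s a x b q [] _ _ = refl
compatibleAfter-skip s a x b q (y ∷ V) x<head h = cong (_∧ compatibleAfter (just (b , y)) q V)
  (admits-after-smaller s a b x y (x<head refl) h)

Annotated : Set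
Annotated = CWord × (List ℤ × List ℤ)

prepend : Letter → (List ℤ × List ℤ → List ℤ × List ℤ) → Annotated → Annotated
prepend c f e = (c ∷ proj₁ e , f (proj₂ e))

-- Each shuffle of p and q comes with the split of m into the entries lying under letters of p and of q.
annotatedShuffles : CWord → CWord → List ℤ → List Annotated
annotatedShuffles [] q m = (q , ([] , m)) ∷ []
annotatedShuffles (a ∷ p) [] m = (a ∷ p , (m , [])) ∷ []
annotatedShuffles (a ∷ p) (b ∷ q) [] = map (λ w → (w , ([] , []))) (shuffle (a ∷ p) (b ∷ q))
annotatedShuffles (a ∷ p) (b ∷ q) (x ∷ m) =
  map (prepend a (map₁ (x ∷_))) (annotatedShuffles p (b ∷ q) m)
  ++ map (prepend b (map₂ (x ∷_))) (annotatedShuffles (a ∷ p) q m)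

map-proj₁-annotatedShuffles : ∀ p q m → map proj₁ (annotatedShuffles p q m) ≡ shuffle p q
map-proj₁-annotatedShuffles [] q m = refl
map-proj₁-annotatedShuffles (a ∷ p) [] m = refl
map-proj₁-annotatedShuffles (a ∷ p) (b ∷ q) [] = trans (sym (Listₚ.map-∘ (shuffle (a ∷ p) (b ∷ q)))) (Listₚ.map-id _)
map-proj₁-annotatedShuffles (a ∷ p) (b ∷ q) (x ∷ m) = begin
  map proj₁ (map (prepend a _) L₁ ++ map (prepend b _) L₂)
    ≡⟨ Listₚ.map-++ proj₁ (map (prepend a _) L₁) _ ⟩
  map proj₁ (map (prepend a _) L₁) ++ map proj₁ (map (prepend b _) L₂)
    ≡⟨ cong₂ _++_ (map-proj₁-prepend a L₁) (map-proj₁-prepend b L₂) ⟩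
  map (a ∷_) (map proj₁ L₁) ++ map (b ∷_) (map proj₁ L₂)
    ≡⟨ cong₂ (λ s₁ s₂ → map (a ∷_) s₁ ++ map (b ∷_) s₂) (map-proj₁-annotatedShuffles p (b ∷ q) m)
         (map-proj₁-annotatedShuffles (a ∷ p) q m) ⟩
  shuffle (a ∷ p) (b ∷ q) ∎
  where
  open ≡-Reasoning
  L₁ = annotatedShuffles p (b ∷ q) m
  L₂ = annotatedShuffles (a ∷ p) q m
  map-proj₁-prepend : ∀ c {f} L → map proj₁ (map (prepend c f) L) ≡ map (c ∷_) (map proj₁ L)
  map-proj₁-prepend c L = trans (sym (Listₚ.map-∘ L)) (Listₚ.map-∘ L)

annotatedShuffles-Split : ∀ p q m {e} → e ∈ annotatedShuffles p q m → Split m (proj₁ (proj₂ e)) (proj₂ (proj₂ e))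
annotatedShuffles-Split [] q m (here refl) = Split-allʳ m
annotatedShuffles-Split (a ∷ p) [] m (here refl) = Split-allˡ m
annotatedShuffles-Split (a ∷ p) (b ∷ q) [] e∈ with ∈ₚ.∈-map⁻ _ e∈
... | _ , _ , refl = []
annotatedShuffles-Split (a ∷ p) (b ∷ q) (x ∷ m) e∈
  with ∈ₚ.∈-++⁻ (map (prepend a (map₁ (x ∷_))) (annotatedShuffles p (b ∷ q) m)) e∈
... | inj₁ e∈₁ with ∈ₚ.∈-map⁻ _ e∈₁
...   | _ , e'∈ , refl = x ∷ˡ annotatedShuffles-Split p (b ∷ q) m e'∈
annotatedShuffles-Split (a ∷ p) (b ∷ q) (x ∷ m) e∈ | inj₂ e∈₂ with ∈ₚ.∈-map⁻ _ e∈₂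
...   | _ , e'∈ , refl = x ∷ʳ annotatedShuffles-Split (a ∷ p) q m e'∈

compatibleAfter-shuffle-[] : ∀ s a p b q {w} → w ∈ shuffle (a ∷ p) (b ∷ q) → compatibleAfter s w [] ≡ false
compatibleAfter-shuffle-[] s a p b q w∈ with ∈ₚ.∈-++⁻ (map (a ∷_) (shuffle p (b ∷ q))) w∈
... | inj₁ w∈₁ with ∈ₚ.∈-map⁻ (a ∷_) w∈₁
...   | _ , _ , refl = refl
compatibleAfter-shuffle-[] s a p b q w∈ | inj₂ w∈₂ with ∈ₚ.∈-map⁻ (b ∷_) w∈₂
...   | _ , _ , refl = refl

countTerm : Prev → List ℤ → List ℤ × List ℤ → Annotated → ℚ
countTerm s m k e = if ⌊ proj₂ e ≟ᴾ k ⌋ then 𝟙 (compatibleAfter s (proj₁ e) m) else 0ℚ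

shuffleCount : Prev → CWord → CWord → List ℤ → List ℤ × List ℤ → ℚ
shuffleCount s p q m k = ∑ (annotatedShuffles p q m) (countTerm s m k)

∑-prepend-hit : ∀ s c x m f L k → (∀ {k₁ k₂} → f k₁ ≡ f k₂ → k₁ ≡ k₂) →
  ∑ (map (prepend c f) L) (countTerm s (x ∷ m) (f k)) ≡ 𝟙 (admits s c x) * ∑ L (countTerm (just (c , x)) m k)
∑-prepend-hit s c x m f L k f-injective =
  trans (∑-map (prepend c f) L _) (trans (∑-cong L term) (∑-*ˡ (𝟙 (admits s c x)) L _))
  where
  term : ∀ e → countTerm s (x ∷ m) (f k) (prepend c f e) ≡ 𝟙 (admits s c x) * countTerm (just (c , x)) m k e
  term e with proj₂ e ≟ᴾ k
  ... | yes refl rewrite ⌊⌋-true (f (proj₂ e) ≟ᴾ f (proj₂ e)) refl = 𝟙-∧ (admits s c x) _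
  ... | no ≢k rewrite ⌊⌋-false (f (proj₂ e) ≟ᴾ f k) (λ eq → ≢k (f-injective eq)) = sym (ℚₚ.*-zeroʳ (𝟙 (admits s c x)))

∑-prepend-miss : ∀ s c m f L k → (∀ k₁ → f k₁ ≢ k) → ∑ (map (prepend c f) L) (countTerm s m k) ≡ 0ℚ
∑-prepend-miss s c m f L k miss = trans (∑-map (prepend c f) L _) (∑-zero L term)
  where
  term : ∀ {e} → e ∈ L → countTerm s m k (prepend c f e) ≡ 0ℚ
  term {e} _ rewrite ⌊⌋-false (f (proj₂ e) ≟ᴾ k) (miss (proj₂ e)) = refl

map₁-∷-injective : ∀ x {k₁ k₂ : List ℤ × List ℤ} → map₁ (x ∷_) k₁ ≡ map₁ (x ∷_) k₂ → k₁ ≡ k₂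
map₁-∷-injective x eq = cong₂ _,_ (Listₚ.∷-injectiveʳ (cong proj₁ eq)) (cong proj₂ eq)

map₂-∷-injective : ∀ x {k₁ k₂ : List ℤ × List ℤ} → map₂ (x ∷_) k₁ ≡ map₂ (x ∷_) k₂ → k₁ ≡ k₂
map₂-∷-injective x eq = cong₂ _,_ (cong proj₁ eq) (Listₚ.∷-injectiveʳ (cong proj₂ eq))

data HeadView (x : ℤ) : List ℤ → Set where
  starts : ∀ U → HeadView x (x ∷ U)
  other : ∀ {U} → (∀ U' → U ≢ x ∷ U') → HeadView x U

headView : ∀ x U → HeadView x U
headView x [] = other (λ _ ())
headView x (y ∷ U) with y ℤ.≟ x
... | yes refl = starts U
... | no y≢x = other (λ U' eq → y≢x (Listₚ.∷-injectiveˡ eq))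

Split-head> : ∀ {x m U V} → Sorted (x ∷ m) → Split m U V → (∀ V' → V ≢ x ∷ V') →
  ∀ {y V'} → V ≡ y ∷ V' → x ℤ.< y
Split-head> sm s ¬starts {V' = V'} refl =
  ℤₚ.≤∧≢⇒< (Sorted-∈ sm (Split-⊆ʳ s (here refl))) (λ { refl → ¬starts V' refl })

Split-both-∷ : ∀ {x m U V} → Sorted (x ∷ m) → Split (x ∷ m) (x ∷ U) (x ∷ V) → Split m U (x ∷ V) × Split m (x ∷ U) V
Split-both-∷ sm (x ∷ˡ s) = s , Split-swap sm s
Split-both-∷ sm (x ∷ʳ s) = Split-sym (Split-swap sm (Split-sym s)) , s

𝟙-guardedˡ : ∀ α P C D → (α ≡ true → C ≡ D) → 𝟙 α * (𝟙 P * 𝟙 C) ≡ 𝟙 (α ∧ P) * 𝟙 D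
𝟙-guardedˡ true P C D C≡D rewrite C≡D refl = ℚₚ.*-identityˡ _
𝟙-guardedˡ false P C D _ = trans (ℚₚ.*-zeroˡ (𝟙 P * 𝟙 C)) (sym (ℚₚ.*-zeroˡ (𝟙 D)))

𝟙-guardedʳ : ∀ β Q C D → (β ≡ true → C ≡ D) → 𝟙 β * (𝟙 C * 𝟙 Q) ≡ 𝟙 D * 𝟙 (β ∧ Q)
𝟙-guardedʳ true Q C D C≡D rewrite C≡D refl = ℚₚ.*-identityˡ _
𝟙-guardedʳ false Q C D _ = trans (ℚₚ.*-zeroˡ (𝟙 C * 𝟙 Q)) (sym (ℚₚ.*-zeroʳ (𝟙 D)))

𝟙-only-second-term : ∀ α β P Q R → (β ≡ true → α ≡ R) →
  𝟙 α * (𝟙 P * 𝟙 false) + 𝟙 β * (𝟙 (R ∧ P) * 𝟙 Q) ≡ 𝟙 (α ∧ P) * 𝟙 (β ∧ Q)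
𝟙-only-second-term α true P Q R α≡R rewrite α≡R refl =
  solve 4 (λ r p rp q → r :* (p :* con 0ℚ) :+ con 1ℚ :* (rp :* q) := rp :* q) refl (𝟙 R) (𝟙 P) (𝟙 (R ∧ P)) (𝟙 Q)
𝟙-only-second-term α false P Q R _ =
  solve 5 (λ a p rp q ap → a :* (p :* con 0ℚ) :+ con 0ℚ :* (rp :* q) := ap :* con 0ℚ) refl
    (𝟙 α) (𝟙 P) (𝟙 (R ∧ P)) (𝟙 Q) (𝟙 (α ∧ P))

𝟙-only-first-term : ∀ α β P Q R → (α ≡ true → β ≡ R) →
  𝟙 α * (𝟙 P * 𝟙 (R ∧ Q)) + 𝟙 β * (𝟙 false * 𝟙 Q) ≡ 𝟙 (α ∧ P) * 𝟙 (β ∧ Q)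
𝟙-only-first-term true β P Q R β≡R rewrite β≡R refl =
  solve 4 (λ r p rq q → con 1ℚ :* (p :* rq) :+ r :* (con 0ℚ :* q) := p :* rq) refl (𝟙 R) (𝟙 P) (𝟙 (R ∧ Q)) (𝟙 Q)
𝟙-only-first-term false β P Q R _ =
  solve 5 (λ b p rq q bq → con 0ℚ :* (p :* rq) :+ b :* (con 0ℚ :* q) := con 0ℚ :* bq) refl
    (𝟙 β) (𝟙 P) (𝟙 (R ∧ Q)) (𝟙 Q) (𝟙 (β ∧ Q))

-- Two columns over equal entries x, x must have weakly decreasing tops, so of the two letters a ≠ b
-- only the larger can come first.
first-column-over-equal-entries : ∀ s a b x P Q → a ≢ b →
  𝟙 (admits s a x) * (𝟙 P * 𝟙 (admits (just (a , x)) b x ∧ Q))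
    + 𝟙 (admits s b x) * (𝟙 (admits (just (b , x)) a x ∧ P) * 𝟙 Q)
  ≡ 𝟙 (admits s a x ∧ P) * 𝟙 (admits s b x ∧ Q)
first-column-over-equal-entries s a b x P Q a≢b
  rewrite admits-same-entry a x b | admits-same-entry b x a with <L-connex a b a≢b
... | inj₁ a<b rewrite a<b | <L-asym a b a<b =
  𝟙-only-second-term (admits s a x) (admits s b x) P Q (x ≤ᵇ val a) (admits-smaller-letter s b a x a<b)
... | inj₂ b<a rewrite b<a | <L-asym b a b<a =
  𝟙-only-first-term (admits s a x) (admits s b x) P Q (x ≤ᵇ val b) (admits-smaller-letter s a b x b<a)

shuffleCount-starts-starts : ∀ s a p b q x m U V → a ≢ b →
  shuffleCount (just (a , x)) p (b ∷ q) m (U , x ∷ V)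
    ≡ 𝟙 (compatibleAfter (just (a , x)) p U) * 𝟙 (compatibleAfter (just (a , x)) (b ∷ q) (x ∷ V)) →
  shuffleCount (just (b , x)) (a ∷ p) q m (x ∷ U , V)
    ≡ 𝟙 (compatibleAfter (just (b , x)) (a ∷ p) (x ∷ U)) * 𝟙 (compatibleAfter (just (b , x)) q V) →
  shuffleCount s (a ∷ p) (b ∷ q) (x ∷ m) (x ∷ U , x ∷ V)
    ≡ 𝟙 (compatibleAfter s (a ∷ p) (x ∷ U)) * 𝟙 (compatibleAfter s (b ∷ q) (x ∷ V))
shuffleCount-starts-starts s a p b q x m U V a≢b countᵃ countᵇ = begin
  ∑ (map (prepend a (map₁ (x ∷_))) L₁ ++ map (prepend b (map₂ (x ∷_))) L₂) (countTerm s (x ∷ m) (x ∷ U , x ∷ V))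
    ≡⟨ ∑-++ (map (prepend a (map₁ (x ∷_))) L₁) _ _ ⟩
  _ ≡⟨ cong₂ _+_ (∑-prepend-hit s a x m (map₁ (x ∷_)) L₁ (U , x ∷ V) (map₁-∷-injective x))
                 (∑-prepend-hit s b x m (map₂ (x ∷_)) L₂ (x ∷ U , V) (map₂-∷-injective x)) ⟩
  𝟙 (admits s a x) * shuffleCount (just (a , x)) p (b ∷ q) m (U , x ∷ V)
    + 𝟙 (admits s b x) * shuffleCount (just (b , x)) (a ∷ p) q m (x ∷ U , V)
    ≡⟨ cong₂ _+_ (cong (𝟙 (admits s a x) *_) countᵃ) (cong (𝟙 (admits s b x) *_) countᵇ) ⟩
  _ ≡⟨ first-column-over-equal-entries s a b x _ _ a≢b ⟩
  𝟙 (compatibleAfter s (a ∷ p) (x ∷ U)) * 𝟙 (compatibleAfter s (b ∷ q) (x ∷ V)) ∎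
  where
  open ≡-Reasoning
  L₁ = annotatedShuffles p (b ∷ q) m
  L₂ = annotatedShuffles (a ∷ p) q m

shuffleCount-starts-other : ∀ s a p b q x m U V → (∀ V' → V ≢ x ∷ V') → (∀ {y V'} → V ≡ y ∷ V' → x ℤ.< y) →
  shuffleCount (just (a , x)) p (b ∷ q) m (U , V)
    ≡ 𝟙 (compatibleAfter (just (a , x)) p U) * 𝟙 (compatibleAfter (just (a , x)) (b ∷ q) V) →
  shuffleCount s (a ∷ p) (b ∷ q) (x ∷ m) (x ∷ U , V) ≡ 𝟙 (compatibleAfter s (a ∷ p) (x ∷ U)) * 𝟙 (compatibleAfter s (b ∷ q) V)
shuffleCount-starts-other s a p b q x m U V ¬startsV x<V countᵃ = begin
  ∑ (map (prepend a (map₁ (x ∷_))) L₁ ++ map (prepend b (map₂ (x ∷_))) L₂) (countTerm s (x ∷ m) (x ∷ U , V))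
    ≡⟨ ∑-++ (map (prepend a (map₁ (x ∷_))) L₁) _ _ ⟩
  _ ≡⟨ cong₂ _+_ (∑-prepend-hit s a x m (map₁ (x ∷_)) L₁ (U , V) (map₁-∷-injective x))
                 (∑-prepend-miss s b (x ∷ m) (map₂ (x ∷_)) L₂ (x ∷ U , V) (λ k eq → ¬startsV (proj₂ k) (sym (cong proj₂ eq)))) ⟩
  𝟙 (admits s a x) * shuffleCount (just (a , x)) p (b ∷ q) m (U , V) + 0ℚ
    ≡⟨ ℚₚ.+-identityʳ _ ⟩
  _ ≡⟨ cong (𝟙 (admits s a x) *_) countᵃ ⟩
  _ ≡⟨ 𝟙-guardedˡ (admits s a x) _ _ _ (compatibleAfter-skip s a x b q V x<V) ⟩
  𝟙 (compatibleAfter s (a ∷ p) (x ∷ U)) * 𝟙 (compatibleAfter s (b ∷ q) V) ∎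
  where
  open ≡-Reasoning
  L₁ = annotatedShuffles p (b ∷ q) m
  L₂ = annotatedShuffles (a ∷ p) q m

shuffleCount-other-starts : ∀ s a p b q x m U V → (∀ U' → U ≢ x ∷ U') → (∀ {y U'} → U ≡ y ∷ U' → x ℤ.< y) →
  shuffleCount (just (b , x)) (a ∷ p) q m (U , V)
    ≡ 𝟙 (compatibleAfter (just (b , x)) (a ∷ p) U) * 𝟙 (compatibleAfter (just (b , x)) q V) →
  shuffleCount s (a ∷ p) (b ∷ q) (x ∷ m) (U , x ∷ V) ≡ 𝟙 (compatibleAfter s (a ∷ p) U) * 𝟙 (compatibleAfter s (b ∷ q) (x ∷ V))
shuffleCount-other-starts s a p b q x m U V ¬startsU x<U countᵇ = begin
  ∑ (map (prepend a (map₁ (x ∷_))) L₁ ++ map (prepend b (map₂ (x ∷_))) L₂) (countTerm s (x ∷ m) (U , x ∷ V))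
    ≡⟨ ∑-++ (map (prepend a (map₁ (x ∷_))) L₁) _ _ ⟩
  _ ≡⟨ cong₂ _+_ (∑-prepend-miss s a (x ∷ m) (map₁ (x ∷_)) L₁ (U , x ∷ V)
                   (λ k eq → ¬startsU (proj₁ k) (sym (cong proj₁ eq))))
                 (∑-prepend-hit s b x m (map₂ (x ∷_)) L₂ (U , V) (map₂-∷-injective x)) ⟩
  0ℚ + 𝟙 (admits s b x) * shuffleCount (just (b , x)) (a ∷ p) q m (U , V)
    ≡⟨ ℚₚ.+-identityˡ _ ⟩
  _ ≡⟨ cong (𝟙 (admits s b x) *_) countᵇ ⟩
  _ ≡⟨ 𝟙-guardedʳ (admits s b x) _ _ _ (compatibleAfter-skip s b x a p U x<U) ⟩
  𝟙 (compatibleAfter s (a ∷ p) U) * 𝟙 (compatibleAfter s (b ∷ q) (x ∷ V)) ∎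
  where
  open ≡-Reasoning
  L₁ = annotatedShuffles p (b ∷ q) m
  L₂ = annotatedShuffles (a ∷ p) q m

shuffleCount-Split : ∀ s p q m u v → Sorted m → Split m u v → Disjoint p q →
  shuffleCount s p q m (u , v) ≡ 𝟙 (compatibleAfter s p u) * 𝟙 (compatibleAfter s q v)
shuffleCount-Split s [] q m [] v _ split _ with Split-[]ˡ split
... | refl rewrite ⌊⌋-true (([] , m) ≟ᴾ ([] , m)) refl =
  trans (ℚₚ.+-identityʳ (𝟙 (compatibleAfter s q m))) (sym (ℚₚ.*-identityˡ (𝟙 (compatibleAfter s q m))))
shuffleCount-Split s [] q m (y ∷ u) v _ _ _ rewrite ⌊⌋-false (([] , m) ≟ᴾ (y ∷ u , v)) (λ ()) =
  sym (ℚₚ.*-zeroˡ (𝟙 (compatibleAfter s q v)))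
shuffleCount-Split s (a ∷ p) [] m u [] _ split _ with Split-[]ʳ split
... | refl rewrite ⌊⌋-true ((m , []) ≟ᴾ (m , [])) refl =
  trans (ℚₚ.+-identityʳ (𝟙 (compatibleAfter s (a ∷ p) m))) (sym (ℚₚ.*-identityʳ (𝟙 (compatibleAfter s (a ∷ p) m))))
shuffleCount-Split s (a ∷ p) [] m u (y ∷ v) _ _ _ rewrite ⌊⌋-false ((m , []) ≟ᴾ (u , y ∷ v)) (λ ()) =
  sym (ℚₚ.*-zeroʳ (𝟙 (compatibleAfter s (a ∷ p) u)))
shuffleCount-Split s (a ∷ p) (b ∷ q) [] .[] .[] _ [] _ =
  trans (∑-map _ (shuffle (a ∷ p) (b ∷ q)) _) (trans (∑-zero _ term) (sym (ℚₚ.*-zeroˡ (𝟙 (compatibleAfter s (b ∷ q) [])))))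
  where
  term : ∀ {w} → w ∈ shuffle (a ∷ p) (b ∷ q) → countTerm s [] ([] , []) (w , ([] , [])) ≡ 0ℚ
  term w∈ rewrite ⌊⌋-true (([] , []) ≟ᴾ ([] , [])) refl | compatibleAfter-shuffle-[] s a p b q w∈ = refl
shuffleCount-Split s (a ∷ p) (b ∷ q) (x ∷ m) U V sm split disjoint with headView x U | headView x V | split
... | starts U' | starts V' | split' =
  shuffleCount-starts-starts s a p b q x m U' V' (λ a≡b → disjoint (here refl , here a≡b))
  (shuffleCount-Split (just (a , x)) p (b ∷ q) m U' (x ∷ V') (Linked.tail sm) (proj₁ (Split-both-∷ sm split')) (contractₗ disjoint))
  (shuffleCount-Split (just (b , x)) (a ∷ p) q m (x ∷ U') V' (Linked.tail sm) (proj₂ (Split-both-∷ sm split')) (contractᵣ disjoint))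
... | starts U' | other ¬startsV | .x ∷ˡ split' =
  shuffleCount-starts-other s a p b q x m U' V ¬startsV (Split-head> sm split' ¬startsV)
  (shuffleCount-Split (just (a , x)) p (b ∷ q) m U' V (Linked.tail sm) split' (contractₗ disjoint))
... | other ¬startsU | starts V' | .x ∷ʳ split' =
  shuffleCount-other-starts s a p b q x m U V' ¬startsU (Split-head> sm (Split-sym split') ¬startsU)
  (shuffleCount-Split (just (b , x)) (a ∷ p) q m U V' (Linked.tail sm) split' (contractᵣ disjoint))
... | starts U' | other ¬startsV | .x ∷ʳ _ = ⊥-elim (¬startsV _ refl)
... | other ¬startsU | starts V' | .x ∷ˡ _ = ⊥-elim (¬startsU _ refl)
... | other ¬startsU | other _ | .x ∷ˡ _ = ⊥-elim (¬startsU _ refl)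
... | other _ | other ¬startsV | .x ∷ʳ _ = ⊥-elim (¬startsV _ refl)

colour≤maxcol : ∀ p → All (λ l → colour l ℕ.≤ maxcol p) p
colour≤maxcol [] = []
colour≤maxcol (l ∷ w) = ℕₚ.m≤m⊔n (colour l) (maxcol w)
  ∷ All.map (λ c≤ → ℕₚ.≤-trans c≤ (ℕₚ.m≤n⊔m (colour l) (maxcol w))) (colour≤maxcol w)

disjoint-↑maxcol : ∀ p q → Disjoint p (q ↑ maxcol p)
disjoint-↑maxcol p q (l∈p , l∈q) with ∈ₚ.∈-map⁻ (shift (maxcol p)) l∈q
... | (_ , k) , _ , refl = ℕₚ.<-irrefl refl (ℕₚ.<-≤-trans (All.lookup (colour≤maxcol p) l∈p) (ℕₚ.m≤n+m (maxcol p) k))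

∑-cprod-slide : ∀ p q m → Sorted m →
  ∑ (cprod p q) (λ w → slide w m) ≡ ∑ (factorisations m) (λ k → slide p (proj₁ k) * slide q (proj₂ k))
∑-cprod-slide p q m sm = begin
  ∑ (shuffle p q') (λ w → slide w m)
    ≡⟨ cong (λ ws → ∑ ws (λ w → slide w m)) (map-proj₁-annotatedShuffles p q' m) ⟨
  ∑ (map proj₁ L) (λ w → slide w m)
    ≡⟨ ∑-map proj₁ L (λ w → slide w m) ⟩
  ∑ L (λ e → slide (proj₁ e) m)
    ≡⟨ ∑-cong L (λ e → slide≡𝟙 (proj₁ e) m) ⟩
  ∑ L (λ e → 𝟙 (compatibleAfter nothing (proj₁ e) m))
    ≡⟨ ∑-fibres proj₂ L _ ks (factorisations-unique m) (λ e∈ → Split→factorisations (annotatedShuffles-Split p q' m e∈)) ⟩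
  ∑ ks (shuffleCount nothing p q' m)
    ≡⟨ ∑-cong-∈ ks (λ {k} k∈ → trans
         (shuffleCount-Split nothing p q' m (proj₁ k) (proj₂ k) sm (factorisations→Split m k∈) (disjoint-↑maxcol p q))
         (cong₂ _*_ (sym (slide≡𝟙 p (proj₁ k)))
           (trans (cong 𝟙 (compatibleAfter-shift (maxcol p) nothing q (proj₂ k))) (sym (slide≡𝟙 q (proj₂ k)))))) ⟩
  ∑ ks (λ k → slide p (proj₁ k) * slide q (proj₂ k)) ∎
  where
  open ≡-Reasoning
  open Grouping _≟ᴾ_ using (∑-fibres)
  q' = q ↑ maxcol p
  L = annotatedShuffles p q' m
  ks = factorisations m

φ-*𝒬-bilinear : ∀ a b m → φ (a *𝒬 b) m ≡
  ∑ a (λ e → ∑ b (λ e' → (proj₁ e * proj₁ e') * ∑ (cprod (proj₂ e) (proj₂ e')) (λ w → slide w m)))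
φ-*𝒬-bilinear a b m = trans (∑-concatMap _ a _) (∑-cong a (λ e → trans (∑-concatMap _ b _) (∑-cong b (λ e' →
  trans (∑-map _ (cprod (proj₂ e) (proj₂ e')) _) (∑-*ˡ (proj₁ e * proj₁ e') (cprod (proj₂ e) (proj₂ e')) (λ w → slide w m))))))

φ-*𝒬 : ∀ a b m → Sorted m → φ (a *𝒬 b) m ≡ (φ a *PS φ b) m
φ-*𝒬 a b m sm = begin
  φ (a *𝒬 b) m
    ≡⟨ φ-*𝒬-bilinear a b m ⟩
  ∑ a (λ e → ∑ b (λ e' → (proj₁ e * proj₁ e') * ∑ (cprod (proj₂ e) (proj₂ e')) (λ w → slide w m)))
    ≡⟨ ∑-cong a (λ e → ∑-cong b (λ e' → cong ((proj₁ e * proj₁ e') *_) (∑-cprod-slide (proj₂ e) (proj₂ e') m sm))) ⟩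
  ∑ a (λ e → ∑ b (λ e' → (proj₁ e * proj₁ e') * ∑ ks (λ k → slide (proj₂ e) (proj₁ k) * slide (proj₂ e') (proj₂ k))))
    ≡⟨ ∑-cong a (λ e → ∑-cong b (λ e' → sym (∑-*ˡ (proj₁ e * proj₁ e') ks _))) ⟩
  ∑ a (λ e → ∑ b (λ e' → ∑ ks (λ k → term e e' k)))
    ≡⟨ ∑-cong a (λ e → ∑-comm b ks (term e)) ⟩
  ∑ a (λ e → ∑ ks (λ k → ∑ b (λ e' → term e e' k)))
    ≡⟨ ∑-comm a ks _ ⟩
  ∑ ks (λ k → ∑ a (λ e → ∑ b (λ e' → term e e' k)))
    ≡⟨ ∑-cong ks (λ k → ∑-cong a (λ e → ∑-cong b (λ e' →
         regroup (proj₁ e) (proj₁ e') (slide (proj₂ e) (proj₁ k)) (slide (proj₂ e') (proj₂ k))))) ⟩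
  ∑ ks (λ k → ∑ a (λ e → ∑ b (λ e' → (proj₁ e * slide (proj₂ e) (proj₁ k)) * (proj₁ e' * slide (proj₂ e') (proj₂ k)))))
    ≡⟨ ∑-cong ks (λ k → trans (∑-cong a (λ e → ∑-*ˡ (proj₁ e * slide (proj₂ e) (proj₁ k)) b _))
                                (∑-*ʳ (φ b (proj₂ k)) a _)) ⟩
  ∑ ks (λ k → φ a (proj₁ k) * φ b (proj₂ k)) ∎
  where
  open ≡-Reasoning
  ks = factorisations m
  term : ℚ × CWord → ℚ × CWord → List ℤ × List ℤ → ℚ
  term e e' k = (proj₁ e * proj₁ e') * (slide (proj₂ e) (proj₁ k) * slide (proj₂ e') (proj₂ k))
  regroup : ∀ c d x y → (c * d) * (x * y) ≡ (c * x) * (d * y)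
  regroup = solve 4 (λ c d x y → (c :* d) :* (x :* y) := (c :* x) :* (d :* y)) refl

-- Maximal bottom rows and the kernel

monochrome : List ℤ → CWord
monochrome = map (λ i → (i , 0))

map-val-monochrome : ∀ r → map val (monochrome r) ≡ r
map-val-monochrome [] = refl
map-val-monochrome (x ∷ r) = cong (x ∷_) (map-val-monochrome r)

maxRowStep : Letter → Letter → ℤ → ℤ
maxRowStep t t' h = if t <L t' then val t ℤ.⊓ (h ℤ.- ℤ.1ℤ) else h

maxRow-∷∷ : ∀ t t' ts {h r} → maxRow (t' ∷ ts) ≡ h ∷ r → maxRow (t ∷ t' ∷ ts) ≡ maxRowStep t t' h ∷ h ∷ r
maxRow-∷∷ t t' ts eq with maxRow (t' ∷ ts)
maxRow-∷∷ t t' ts refl | _ = refl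

maxRow-nonempty : ∀ t ts → ∃[ h ] ∃[ r ] maxRow (t ∷ ts) ≡ h ∷ r
maxRow-nonempty t [] = val t , [] , refl
maxRow-nonempty t (t' ∷ ts) with maxRow-nonempty t' ts
... | h , r , eq = maxRowStep t t' h , h ∷ r , maxRow-∷∷ t t' ts eq

<⇒≤-1 : ∀ {x h} → x ℤ.< h → x ℤ.≤ h ℤ.- ℤ.1ℤ
<⇒≤-1 {x} {h} x<h = subst (x ℤ.≤_) (ℤₚ.+-comm ℤ.-1ℤ h) (ℤₚ.i<j⇒i≤pred[j] x<h)

≤-1⇒< : ∀ {x h} → x ℤ.≤ h ℤ.- ℤ.1ℤ → x ℤ.< h
≤-1⇒< {x} {h} x≤ = ℤₚ.i≤pred[j]⇒i<j (subst (x ℤ.≤_) (ℤₚ.+-comm h ℤ.-1ℤ) x≤)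

maxRowStep≤ : ∀ t t' h → maxRowStep t t' h ℤ.≤ h
maxRowStep≤ t t' h with t <L t'
... | true = ℤₚ.≤-trans (ℤₚ.i⊓j≤j (val t) _) (ℤₚ.<⇒≤ (≤-1⇒< ℤₚ.≤-refl))
... | false = ℤₚ.≤-refl

maxRowStep-ascent : ∀ t t' h → ((maxRowStep t t' h , 0) <L (h , 0)) ≡ (t <L t')
maxRowStep-ascent t t' h with t <L t'
... | true = <L-val (val t ℤ.⊓ (h ℤ.- ℤ.1ℤ) , 0) (h , 0) (≤-1⇒< (ℤₚ.i⊓j≤j (val t) (h ℤ.- ℤ.1ℤ)))
... | false = <L-irrefl (h , 0)

compatible-head : ∀ l w y bs → compatible (l ∷ w) (y ∷ bs) ≡ true → y ℤ.≤ val l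
compatible-head l w y bs e = ≤ᵇ-sound (∧-trueˡ (trans (sym (compatible-∷ l y w bs)) e))

∧-cong-under : ∀ P P' Q R C → (C ≡ true → Q ≡ true → R ≡ true → P ≡ P') →
  P ∧ (Q ∧ (R ∧ C)) ≡ P' ∧ (Q ∧ (R ∧ C))
∧-cong-under P P' true true true P≡P' rewrite P≡P' refl refl refl = refl
∧-cong-under P P' false Q R _ rewrite Boolₚ.∧-zeroʳ P | Boolₚ.∧-zeroʳ P' = refl
∧-cong-under P P' true false R _ rewrite Boolₚ.∧-zeroʳ P | Boolₚ.∧-zeroʳ P' = refl
∧-cong-under P P' true true false _ rewrite Boolₚ.∧-zeroʳ P | Boolₚ.∧-zeroʳ P' = refl

compatible-maxRow : ∀ t b → compatible t b ≡ compatible (monochrome (maxRow t)) b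
compatible-maxRow-∷∷ : ∀ t t' ts → (∀ b → compatible (t' ∷ ts) b ≡ compatible (monochrome (maxRow (t' ∷ ts))) b) →
  ∀ b → compatible (t ∷ t' ∷ ts) b ≡ compatible (monochrome (maxRow (t ∷ t' ∷ ts))) b

compatible-maxRow [] b = refl
compatible-maxRow (t ∷ []) [] = refl
compatible-maxRow (t ∷ []) (x ∷ []) = refl
compatible-maxRow (t ∷ []) (x ∷ y ∷ b) = refl
compatible-maxRow (t ∷ t' ∷ ts) = compatible-maxRow-∷∷ t t' ts (compatible-maxRow (t' ∷ ts))

-- The monochrome word on m(t) has the same ascents as t, and both bound the entries by m(t).
compatible-maxRow-∷∷ t t' ts ih₀ b with maxRow-nonempty t' ts
... | h , r , eq rewrite maxRow-∷∷ t t' ts eq = step b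
  where
  ih : ∀ b' → compatible (t' ∷ ts) b' ≡ compatible ((h , 0) ∷ monochrome r) b'
  ih b' = trans (ih₀ b') (cong (λ z → compatible (monochrome z) b') eq)
  step : ∀ b → compatible (t ∷ t' ∷ ts) b ≡ compatible ((maxRowStep t t' h , 0) ∷ (h , 0) ∷ monochrome r) b
  step [] = refl
  step (x ∷ []) = refl
  step (x ∷ y ∷ bs) rewrite ih (y ∷ bs) | maxRowStep-ascent t t' h =
    ∧-cong-under (x ≤ᵇ val t) (x ≤ᵇ maxRowStep t t' h) (x ≤ᵇ y) (if t <L t' then ℤ.suc x ≤ᵇ y else true) _ bound
    where
    bound : compatible ((h , 0) ∷ monochrome r) (y ∷ bs) ≡ true → (x ≤ᵇ y) ≡ true →
      (if t <L t' then ℤ.suc x ≤ᵇ y else true) ≡ true → (x ≤ᵇ val t) ≡ (x ≤ᵇ maxRowStep t t' h)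
    bound c x≤y ascent with t <L t' in t<t'
    ... | true = Bool-ext
      (λ x≤t → ≤ᵇ-complete {x} (ℤₚ.⊓-glb (≤ᵇ-sound {x} x≤t) x≤h-1))
      (λ x≤t⊓ → ≤ᵇ-complete {x} (ℤₚ.i≤j⊓k⇒i≤j (val t) _ (≤ᵇ-sound {x} x≤t⊓)))
      where
      x≤h-1 : x ℤ.≤ h ℤ.- ℤ.1ℤ
      x≤h-1 = <⇒≤-1 (ℤₚ.<-≤-trans (ℤₚ.suc[i]≤j⇒i<j (≤ᵇ-sound ascent)) (compatible-head (h , 0) (monochrome r) y bs c))
    ... | false = trans (≤ᵇ-complete {x} x≤t) (sym (≤ᵇ-complete {x} (ℤₚ.≤-trans (≤ᵇ-sound {x} x≤y) y≤h)))
      where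
      y≤h : y ℤ.≤ h
      y≤h = compatible-head (h , 0) (monochrome r) y bs c
      y≤t' : y ℤ.≤ val t'
      y≤t' = compatible-head t' ts y bs (trans (ih (y ∷ bs)) c)
      x≤t : x ℤ.≤ val t
      x≤t = ℤₚ.≤-trans (≤ᵇ-sound {x} x≤y) (ℤₚ.≤-trans y≤t' (¬<L⇒val≥ t t' t<t'))

slide-maxRow : ∀ t b → slide t b ≡ slide (monochrome (maxRow t)) b
slide-maxRow t b = cong 𝟙 (compatible-maxRow t b)

maxRow-sorted : ∀ t → Sorted (maxRow t)
maxRow-sorted [] = []
maxRow-sorted (t ∷ []) = [-]
maxRow-sorted (t ∷ t' ∷ ts) with maxRow-nonempty t' ts | maxRow-sorted (t' ∷ ts)
... | h , r , eq | sorted = subst Sorted (sym (maxRow-∷∷ t t' ts eq)) (maxRowStep≤ t t' h ∷ subst Sorted eq sorted)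

maxRow-monochrome : ∀ r → Sorted r → maxRow (monochrome r) ≡ r
maxRow-monochrome [] _ = refl
maxRow-monochrome (x ∷ []) _ = refl
maxRow-monochrome (x ∷ y ∷ r) (x≤y ∷ sr)
  rewrite maxRow-∷∷ (x , 0) (y , 0) (monochrome r) (maxRow-monochrome (y ∷ r) sr) = cong (_∷ y ∷ r) step
  where
  step : maxRowStep (x , 0) (y , 0) y ≡ x
  step with x ℤ.≟ y
  ... | yes refl rewrite <L-irrefl (x , 0) = refl
  ... | no x≢y with ℤₚ.≤∧≢⇒< x≤y x≢y
  ...   | x<y rewrite <L-val (x , 0) (y , 0) x<y = ℤₚ.i≤j⇒i⊓j≡i (<⇒≤-1 x<y)

compatible-monochrome-self : ∀ r → Sorted r → compatible (monochrome r) r ≡ true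
compatible-monochrome-self [] _ = refl
compatible-monochrome-self (x ∷ []) _ = ≤ᵇ-refl x
compatible-monochrome-self (x ∷ y ∷ r) (x≤y ∷ sr) =
  ∧-true (≤ᵇ-refl x) (∧-true (≤ᵇ-complete x≤y) (∧-true ascent (compatible-monochrome-self (y ∷ r) sr)))
  where
  ascent : (if (x , 0) <L (y , 0) then ℤ.suc x ≤ᵇ y else true) ≡ true
  ascent with (x , 0) <L (y , 0) in x<y
  ... | false = refl
  ... | true with <L⇒≺ (x , 0) (y , 0) x<y
  ...   | inj₁ x<y = ≤ᵇ-complete (ℤₚ.i<j⇒suc[i]≤j x<y)
  ...   | inj₂ (_ , ())

compatible⇒≤vals : ∀ t b → compatible t b ≡ true → Pointwise ℤ._≤_ b (map val t)
compatible⇒≤vals t b e = compatibleAfter⇒≤vals nothing t b (trans (sym (compatible≡compatibleAfter t b)) e)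

compatible-monochrome⇒≤ : ∀ k r → compatible (monochrome k) r ≡ true → Pointwise ℤ._≤_ r k
compatible-monochrome⇒≤ k r e = subst (Pointwise ℤ._≤_ r) (map-val-monochrome k) (compatible⇒≤vals (monochrome k) r e)

module _ {A : Set} {P Q : A → Set} (P? : U.Decidable P) (Q? : U.Decidable Q) (P⇒Q : ∀ {x} → P x → Q x) where

  length-filter-mono : ∀ xs → length (filter P? xs) ℕ.≤ length (filter Q? xs)
  length-filter-mono [] = ℕ.z≤n
  length-filter-mono (x ∷ xs) with P? x | Q? x
  ... | yes _ | yes _ = ℕ.s≤s (length-filter-mono xs)
  ... | yes p | no ¬q = ⊥-elim (¬q (P⇒Q p))
  ... | no _ | yes _ = ℕₚ.m≤n⇒m≤1+n (length-filter-mono xs)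
  ... | no _ | no _ = length-filter-mono xs

  length-filter-< : ∀ {xs x₀} → x₀ ∈ xs → Q x₀ → ¬ P x₀ → length (filter P? xs) ℕ.< length (filter Q? xs)
  length-filter-< {x ∷ xs} (here refl) q ¬p with P? x | Q? x
  ... | yes p | _ = ⊥-elim (¬p p)
  ... | no _ | no ¬q = ⊥-elim (¬q q)
  ... | no _ | yes _ = ℕ.s≤s (length-filter-mono xs)
  length-filter-< {x ∷ xs} (there x₀∈) q ¬p with P? x | Q? x
  ... | yes _ | yes _ = ℕ.s≤s (length-filter-< x₀∈ q ¬p)
  ... | yes p | no ¬q = ⊥-elim (¬q (P⇒Q p))
  ... | no _ | yes _ = ℕₚ.m≤n⇒m≤1+n (length-filter-< x₀∈ q ¬p)
  ... | no _ | no _ = length-filter-< x₀∈ q ¬p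

_≟ˡ_ : DecidableEquality (List ℤ)
_≟ˡ_ = Listₚ.≡-dec ℤ._≟_

monochrome-injective : ∀ {k k'} → monochrome k ≡ monochrome k' → k ≡ k'
monochrome-injective {k} {k'} eq = trans (sym (map-val-monochrome k)) (trans (cong (map val) eq) (map-val-monochrome k'))

rowOf : ℚ × CWord → List ℤ
rowOf e = maxRow (proj₂ e)

-- Triangularity: the slide polynomial of the monochrome word on r has the monomial x_r, and all its
-- other monomials lie strictly below r; so the coefficients are forced to vanish from the top down.
module RowCoefficients (a : 𝒬) (φa≈0 : φ a ≈PS 0PS) where

  open Grouping _≟ˡ_ using (∑-group; ∑-≟-∈; keys; keys-unique; ∈-keys⁺; ∈-keys⁻)

  coeffRow : List ℤ → ℚ
  coeffRow r = ∑ a (λ e → if ⌊ rowOf e ≟ˡ r ⌋ then proj₁ e else 0ℚ)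

  StrictlyAbove : List ℤ → List ℤ → Set
  StrictlyAbove r k = Pointwise ℤ._≤_ r k × k ≢ r

  strictlyAbove? : ∀ r k → Dec (StrictlyAbove r k)
  strictlyAbove? r k = Pointwise.decidable ℤ._≤?_ r k ×-dec ¬? (k ≟ˡ r)

  StrictlyAbove-trans : ∀ {r k} → StrictlyAbove r k → ∀ {l} → StrictlyAbove k l → StrictlyAbove r l
  StrictlyAbove-trans (r≤k , k≢r) (k≤l , l≢k) = Pointwise.transitive ℤₚ.≤-trans r≤k k≤l
    , λ { refl → k≢r (Pointwise.Pointwise-≡⇒≡ (Pointwise.antisymmetric ℤₚ.≤-antisym k≤l r≤k)) }

  height : List ℤ → ℕ
  height r = length (filter (λ e → strictlyAbove? r (rowOf e)) a)

  height-< : ∀ {r k} → StrictlyAbove r k → k ∈ map rowOf a → height k ℕ.< height r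
  height-< r<k k∈ with ∈ₚ.∈-map⁻ rowOf k∈
  ... | e , e∈ , refl = length-filter-< _ _ (StrictlyAbove-trans r<k) e∈ r<k (λ (_ , k≢k) → k≢k refl)

  coeffRow-step : ∀ r → (∀ k → height k ℕ.< height r → coeffRow k ≡ 0ℚ) → coeffRow r ≡ 0ℚ
  coeffRow-step r ih with Any.any? (r ≟ˡ_) (map rowOf a)
  ... | no r∉ = ∑-zero a (λ {e} e∈ → cong (λ b → if b then proj₁ e else 0ℚ)
        (⌊⌋-false (rowOf e ≟ˡ r) (λ { refl → r∉ (∈ₚ.∈-map⁺ rowOf e∈) })))
  ... | yes r∈ with ∈ₚ.∈-map⁻ rowOf r∈
  ...   | e₀ , e₀∈ , refl = sym (begin
    0ℚ
      ≡⟨ φa≈0 r (maxRow-sorted (proj₂ e₀)) ⟨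
    φ a r
      ≡⟨ ∑-cong a (λ e → cong (proj₁ e *_) (slide-maxRow (proj₂ e) r)) ⟩
    ∑ a (λ e → proj₁ e * slide (monochrome (rowOf e)) r)
      ≡⟨ ∑-group rowOf proj₁ (λ k → slide (monochrome k) r) a ks (keys-unique rowOf a) (∈-keys⁺ rowOf a) ⟩
    ∑ ks (λ k → coeffRow k * slide (monochrome k) r)
      ≡⟨ ∑-cong-∈ ks diagonal ⟩
    ∑ ks (λ k → if ⌊ r ≟ˡ k ⌋ then coeffRow r else 0ℚ)
      ≡⟨ ∑-≟-∈ ks (keys-unique rowOf a) r (∈-keys⁺ rowOf a e₀∈) (coeffRow r) ⟩
    coeffRow r ∎)
    where
    open ≡-Reasoning
    ks = keys rowOf a
    diagonal : ∀ {k} → k ∈ ks → coeffRow k * slide (monochrome k) r ≡ (if ⌊ r ≟ˡ k ⌋ then coeffRow r else 0ℚ)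
    diagonal {k} k∈ with r ≟ˡ k
    ... | yes refl rewrite compatible-monochrome-self r (maxRow-sorted (proj₂ e₀)) = ℚₚ.*-identityʳ (coeffRow r)
    ... | no r≢k with compatible (monochrome k) r in compat
    ...   | false = ℚₚ.*-zeroʳ (coeffRow k)
    ...   | true = cong (_* 1ℚ) (ih k (height-< r<k (∈-keys⁻ rowOf a k∈)))
      where
      r<k : StrictlyAbove r k
      r<k = compatible-monochrome⇒≤ k r compat , λ k≡r → r≢k (sym k≡r)

  coeffRow≡0 : ∀ r → coeffRow r ≡ 0ℚ
  coeffRow≡0 = WF.All.wfRec (On.wellFounded height <-wellFounded) 0ℓ (λ r → coeffRow r ≡ 0ℚ)
    (λ r rec → coeffRow-step r (λ k → rec))

  coeffMonochrome : CWord → ℚ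
  coeffMonochrome w = ∑ a (λ e → if ⌊ monochrome (rowOf e) ≟ᵂ w ⌋ then proj₁ e else 0ℚ)

  coeffMonochrome≡0 : ∀ w → coeffMonochrome w ≡ 0ℚ
  coeffMonochrome≡0 w with monochrome (map val w) ≟ᵂ w
  ... | yes w-mono = trans (∑-cong a (λ e → cong (λ b → if b then proj₁ e else 0ℚ) (same-test (rowOf e)))) (coeffRow≡0 (map val w))
    where
    same-test : ∀ k → ⌊ monochrome k ≟ᵂ w ⌋ ≡ ⌊ k ≟ˡ map val w ⌋
    same-test k with monochrome k ≟ᵂ w | k ≟ˡ map val w
    ... | yes _ | yes _ = refl
    ... | no _ | no _ = refl
    ... | yes eq | no ne = ⊥-elim (ne (monochrome-injective (trans eq (sym w-mono))))
    ... | no ne | yes eq = ⊥-elim (ne (trans (cong monochrome eq) w-mono))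
  ... | no w-not-mono = ∑-zero a (λ {e} _ → cong (λ b → if b then proj₁ e else 0ℚ)
    (⌊⌋-false (monochrome (rowOf e) ≟ᵂ w) (λ { refl → w-not-mono (cong monochrome (map-val-monochrome (rowOf e))) })))

difference : ℚ × CWord × CWord → 𝒬
difference (c , p , q) = c ·𝒬 (word p -𝒬 word q)

φ-foldr-+𝒬 : {A : Set} (g : A → 𝒬) (L : List A) (m : List ℤ) → φ (foldr _+𝒬_ [] (map g L)) m ≡ ∑ L (λ x → φ (g x) m)
φ-foldr-+𝒬 g [] m = refl
φ-foldr-+𝒬 g (x ∷ L) m = trans (φ-+ (g x) _ m) (cong (φ (g x) m +_) (φ-foldr-+𝒬 g L m))

coeff𝒬-foldr-+𝒬 : {A : Set} (g : A → 𝒬) (L : List A) (w : CWord) →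
  coeff𝒬 (foldr _+𝒬_ [] (map g L)) w ≡ ∑ L (λ x → coeff𝒬 (g x) w)
coeff𝒬-foldr-+𝒬 g [] w = refl
coeff𝒬-foldr-+𝒬 g (x ∷ L) w = trans (∑-++ (g x) _ _) (cong (coeff𝒬 (g x) w +_) (coeff𝒬-foldr-+𝒬 g L w))

φ-difference-≡m : ∀ c p q m → p ≡m q → φ (difference (c , p , q)) m ≡ 0ℚ
φ-difference-≡m c p q m p≡q rewrite slide-maxRow p m | slide-maxRow q m | p≡q =
  solve 2 (λ c s → (c :* con 1ℚ) :* s :+ ((c :* (:- con 1ℚ :* con 1ℚ)) :* s :+ con 0ℚ) := con 0ℚ) refl
    c (slide (monochrome (maxRow q)) m)

coeff𝒬-difference : ∀ c p q w →
  coeff𝒬 (difference (c , p , q)) w ≡ (if ⌊ p ≟ᵂ w ⌋ then c else 0ℚ) + - (if ⌊ q ≟ᵂ w ⌋ then c else 0ℚ)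
coeff𝒬-difference c p q w with ⌊ p ≟ᵂ w ⌋ | ⌊ q ≟ᵂ w ⌋
... | true | true = solve 1 (λ c → c :* con 1ℚ :+ ((c :* (:- con 1ℚ :* con 1ℚ)) :+ con 0ℚ) := c :+ :- c) refl c
... | true | false = solve 1 (λ c → c :* con 1ℚ :+ (con 0ℚ :+ con 0ℚ) := c :+ :- con 0ℚ) refl c
... | false | true = solve 1 (λ c → con 0ℚ :+ ((c :* (:- con 1ℚ :* con 1ℚ)) :+ con 0ℚ) := con 0ℚ :+ :- c) refl c
... | false | false = refl

Spans : 𝒬 → Set
Spans a = Σ (List (ℚ × CWord × CWord)) λ L → All (λ { (c , p , q) → p ≡m q }) L
  × (a ≈𝒬 foldr _+𝒬_ [] (map (λ { (c , p , q) → c ·𝒬 (word p -𝒬 word q) }) L))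

kernel-⊇ : ∀ a → Spans a → φ a ≈PS 0PS
kernel-⊇ a (L , equivalent , a≈) m _ =
  trans (φ-resp-≈𝒬 a (foldr _+𝒬_ [] (map difference L)) a≈ m) (trans (φ-foldr-+𝒬 difference L m)
    (∑-zero L (λ {(c , p , q)} x∈ → φ-difference-≡m c p q m (All.lookup equivalent x∈))))

kernel-⊆ : ∀ a → φ a ≈PS 0PS → Spans a
kernel-⊆ a φa≈0 = map toMonochrome a , All.tabulate equivalent , a≈
  where
  open RowCoefficients a φa≈0
  toMonochrome : ℚ × CWord → ℚ × CWord × CWord
  toMonochrome e = (proj₁ e , proj₂ e , monochrome (rowOf e))
  equivalent : ∀ {x} → x ∈ map toMonochrome a → proj₁ (proj₂ x) ≡m proj₂ (proj₂ x)
  equivalent x∈ with ∈ₚ.∈-map⁻ toMonochrome x∈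
  ... | e , _ , refl = sym (maxRow-monochrome (rowOf e) (maxRow-sorted (proj₂ e)))
  a≈ : a ≈𝒬 foldr _+𝒬_ [] (map difference (map toMonochrome a))
  a≈ w = sym (begin
    coeff𝒬 (foldr _+𝒬_ [] (map difference (map toMonochrome a))) w
      ≡⟨ coeff𝒬-foldr-+𝒬 difference (map toMonochrome a) w ⟩
    ∑ (map toMonochrome a) (λ x → coeff𝒬 (difference x) w)
      ≡⟨ ∑-map toMonochrome a _ ⟩
    ∑ a (λ e → coeff𝒬 (difference (toMonochrome e)) w)
      ≡⟨ ∑-cong a (λ e → coeff𝒬-difference (proj₁ e) (proj₂ e) (monochrome (rowOf e)) w) ⟩
    ∑ a (λ e → (if ⌊ proj₂ e ≟ᵂ w ⌋ then proj₁ e else 0ℚ) + - (if ⌊ monochrome (rowOf e) ≟ᵂ w ⌋ then proj₁ e else 0ℚ))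
      ≡⟨ ∑-+ a _ _ ⟩
    coeff𝒬 a w + ∑ a (λ e → - (if ⌊ monochrome (rowOf e) ≟ᵂ w ⌋ then proj₁ e else 0ℚ))
      ≡⟨ cong (coeff𝒬 a w +_) (trans (∑-neg a _) (cong -_ (coeffMonochrome≡0 w))) ⟩
    coeff𝒬 a w + - 0ℚ
      ≡⟨ ℚₚ.+-identityʳ (coeff𝒬 a w) ⟩
    coeff𝒬 a w ∎)
    where
    open ≡-Reasoning

-- The image is back-quasisymmetric

Sorted-++ˡ : ∀ l h → Sorted (l ++ h) → Sorted l
Sorted-++ˡ [] h _ = []
Sorted-++ˡ (x ∷ []) h _ = [-]
Sorted-++ˡ (x ∷ y ∷ l) h (x≤y ∷ s) = x≤y ∷ Sorted-++ˡ (y ∷ l) h s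

low-≤ : ∀ M m → All (ℤ._≤ M) (low M m)
low-≤ M m = Allₚ.all-filter (λ i → i ℤ.≤? M) m

high-> : ∀ M m → All (M ℤ.<_) (high M m)
high-> M m = All.map ℤₚ.suc[i]≤j⇒i<j (Allₚ.all-filter (λ i → ℤ.suc M ℤ.≤? i) m)

low-all : ∀ M m → All (ℤ._≤ M) m → low M m ≡ m
low-all M m m≤M = Listₚ.filter-all (λ i → i ℤ.≤? M) m≤M

high-none : ∀ M m → All (ℤ._≤ M) m → high M m ≡ []
high-none M m m≤M = Listₚ.filter-none (λ i → ℤ.suc M ℤ.≤? i)
  (All.map (λ x≤M M<x → ℤₚ.<-irrefl refl (ℤₚ.<-≤-trans (ℤₚ.suc[i]≤j⇒i<j M<x) x≤M)) m≤M)

sorted-low++high : ∀ M m → Sorted m → m ≡ low M m ++ high M m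
sorted-low++high M [] _ = refl
sorted-low++high M (x ∷ m) sm with x ℤ.≤? M
... | yes x≤M
  rewrite Listₚ.filter-reject (λ i → ℤ.suc M ℤ.≤? i) {x} {m} (λ M<x → ℤₚ.<-irrefl refl (ℤₚ.<-≤-trans (ℤₚ.suc[i]≤j⇒i<j M<x) x≤M)) =
  cong (x ∷_) (sorted-low++high M m (Linked.tail sm))
... | no x≰M with ℤₚ.i<j⇒suc[i]≤j (ℤₚ.≰⇒> x≰M)
...   | M<x
  rewrite Listₚ.filter-none (λ i → i ℤ.≤? M) {m} (All.map (λ x≤y y≤M → x≰M (ℤₚ.≤-trans x≤y y≤M)) (Sorted-head≤ sm))
        | Listₚ.filter-accept (λ i → ℤ.suc M ℤ.≤? i) {x} {m} M<x
        | Listₚ.filter-all (λ i → ℤ.suc M ℤ.≤? i) {m} (All.map (ℤₚ.≤-trans M<x) (Sorted-head≤ sm)) = refl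

ascents : List ℤ → List Bool
ascents [] = []
ascents (x ∷ []) = []
ascents (x ∷ y ∷ r) = (ℤ.suc x ≤ᵇ y) ∷ ascents (y ∷ r)

length-ascents : ∀ x m → length (ascents (x ∷ m)) ≡ length m
length-ascents x [] = refl
length-ascents x (y ∷ m) = cong suc (length-ascents y m)

incHead : List ℕ → List ℕ
incHead [] = []
incHead (n ∷ r) = suc n ∷ r

runsOf : List Bool → List ℕ
runsOf [] = 1 ∷ []
runsOf (true ∷ σ) = 1 ∷ runsOf σ
runsOf (false ∷ σ) = incHead (runsOf σ)

runsOf-positive : ∀ σ → ∃[ n ] ∃[ r ] runsOf σ ≡ suc n ∷ r
runsOf-positive [] = 0 , [] , refl
runsOf-positive (true ∷ σ) = 0 , runsOf σ , refl
runsOf-positive (false ∷ σ) with runsOf-positive σ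
... | n , r , eq rewrite eq = suc n , r , refl

decodeRuns : List ℕ → List Bool
decodeRun : ℕ → List ℕ → List Bool
decodeRuns [] = []
decodeRuns (zero ∷ _) = []
decodeRuns (suc n ∷ r) = decodeRun n r
decodeRun zero [] = []
decodeRun zero (k ∷ r) = true ∷ decodeRuns (k ∷ r)
decodeRun (suc n) r = false ∷ decodeRun n r

decodeRuns-runsOf : ∀ σ → decodeRuns (runsOf σ) ≡ σ
decodeRuns-runsOf [] = refl
decodeRuns-runsOf (true ∷ σ) with runsOf σ | runsOf-positive σ | decodeRuns-runsOf σ
... | _ | n , r , refl | ih = cong (true ∷_) ih
decodeRuns-runsOf (false ∷ σ) with runsOf σ | runsOf-positive σ | decodeRuns-runsOf σ
... | _ | n , r , refl | ih = cong (false ∷_) ih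

runsOf-injective : ∀ {σ σ'} → runsOf σ ≡ runsOf σ' → σ ≡ σ'
runsOf-injective {σ} {σ'} eq = trans (sym (decodeRuns-runsOf σ)) (trans (cong decodeRuns eq) (decodeRuns-runsOf σ'))

runs-∷∷ : ∀ x y r {n rs} → runs (y ∷ r) ≡ n ∷ rs →
  runs (x ∷ y ∷ r) ≡ (if (x ≤ᵇ y) ∧ (y ≤ᵇ x) then suc n ∷ rs else 1 ∷ n ∷ rs)
runs-∷∷ x y r eq with runs (y ∷ r)
runs-∷∷ x y r refl | _ = refl

runs≡runsOf-ascents : ∀ x l → Sorted (x ∷ l) → runs (x ∷ l) ≡ runsOf (ascents (x ∷ l))
runs≡runsOf-ascents x [] _ = refl
runs≡runsOf-ascents x (y ∷ r) (x≤y ∷ s) with runsOf-positive (ascents (y ∷ r))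
... | n , rs , eq rewrite runs-∷∷ x y r (trans (runs≡runsOf-ascents y r s) eq) with x ℤ.≟ y
...   | yes refl rewrite ≤ᵇ-refl x | suc-≤ᵇ-false x | eq = refl
...   | no x≢y rewrite ≤ᵇ-complete x≤y | ≤ᵇ-complete (ℤₚ.i<j⇒suc[i]≤j (ℤₚ.≤∧≢⇒< x≤y x≢y)) | eq
        | ≤ᵇ-false {y} (λ y≤x → x≢y (ℤₚ.≤-antisym x≤y y≤x)) = refl

data SameShape : List ℤ → List ℤ → Set where
  both-[] : SameShape [] []
  both-∷ : ∀ {x l x' l'} → ascents (x ∷ l) ≡ ascents (x' ∷ l') → SameShape (x ∷ l) (x' ∷ l')

runs⇒SameShape : ∀ l l' → Sorted l → Sorted l' → runs l ≡ runs l' → SameShape l l'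
runs⇒SameShape [] [] _ _ _ = both-[]
runs⇒SameShape [] (x ∷ l') _ s' eq with runsOf-positive (ascents (x ∷ l'))
... | _ , _ , eq' with () ← trans eq (trans (runs≡runsOf-ascents x l' s') eq')
runs⇒SameShape (x ∷ l) [] s _ eq with runsOf-positive (ascents (x ∷ l))
... | _ , _ , eq' with () ← trans (sym eq) (trans (runs≡runsOf-ascents x l s) eq')
runs⇒SameShape (x ∷ l) (x' ∷ l') s s' eq =
  both-∷ (runsOf-injective (trans (sym (runs≡runsOf-ascents x l s)) (trans eq (runs≡runsOf-ascents x' l' s'))))

SameShape⇒runs : ∀ l l' → Sorted l → Sorted l' → SameShape l l' → runs l ≡ runs l'
SameShape⇒runs [] [] _ _ both-[] = refl
SameShape⇒runs (x ∷ l) (x' ∷ l') s s' (both-∷ eq) =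
  trans (runs≡runsOf-ascents x l s) (trans (cong runsOf eq) (sym (runs≡runsOf-ascents x' l' s')))

module ℕ-Extrema = Data.List.Extrema ℕₚ.≤-totalOrder
module ℤ-Extrema = Data.List.Extrema ℤₚ.≤-totalOrder

wordLengths : 𝒬 → List ℕ
wordLengths a = map (λ e → length (proj₂ e)) a

letterValues : 𝒬 → List ℤ
letterValues a = concatMap (λ e → map val (proj₂ e)) a

∈-letterValues : ∀ a {e} → e ∈ a → ∀ {l} → l ∈ proj₂ e → val l ∈ letterValues a
∈-letterValues a e∈ l∈ =
  ∈ₚ.∈-concatMap⁺ (λ e → map val (proj₂ e)) {xs = a} (Any.map (λ { refl → ∈ₚ.∈-map⁺ val l∈ }) e∈)

slide≢0⇒compatible : ∀ t m c → c * slide t m ≢ 0ℚ → compatible t m ≡ true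
slide≢0⇒compatible t m c ≢0 = ¬false⇒true (λ incompatible → ≢0 (trans (cong (λ b → c * 𝟙 b) incompatible) (ℚₚ.*-zeroʳ c)))

φ-boundedDegree : ∀ a → BoundedDegree (φ a)
φ-boundedDegree a = ℕ-Extrema.max 0 (wordLengths a) , λ m _ long → ∑-zero a (λ e∈ → short e∈ m long)
  where
  short : ∀ {e} → e ∈ a → ∀ m → ℕ-Extrema.max 0 (wordLengths a) ℕ.< length m → proj₁ e * slide (proj₂ e) m ≡ 0ℚ
  short {e} e∈ m long with ℚₚ._≟_ (proj₁ e * slide (proj₂ e) m) 0ℚ
  ... | yes ≡0 = ≡0
  ... | no ≢0 = ⊥-elim (ℕₚ.<-irrefl refl (ℕₚ.≤-<-trans (subst (ℕ._≤ _) same-length bound) long))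
    where
    bound : length (proj₂ e) ℕ.≤ ℕ-Extrema.max 0 (wordLengths a)
    bound = All.lookup (ℕ-Extrema.xs≤max 0 (wordLengths a)) (∈ₚ.∈-map⁺ (λ e → length (proj₂ e)) e∈)
    same-length : length (proj₂ e) ≡ length m
    same-length = compatibleAfter⇒length nothing (proj₂ e) m
      (trans (sym (compatible≡compatibleAfter (proj₂ e) m)) (slide≢0⇒compatible (proj₂ e) m (proj₁ e) ≢0))

Pointwise-≤-All : ∀ {N m vs} → Pointwise ℤ._≤_ m vs → All (ℤ._≤ N) vs → All (ℤ._≤ N) m
Pointwise-≤-All [] [] = []
Pointwise-≤-All (x≤v ∷ m≤vs) (v≤N ∷ vs≤N) = ℤₚ.≤-trans x≤v v≤N ∷ Pointwise-≤-All m≤vs vs≤N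

φ-supportBoundedAbove : ∀ a → SupportBoundedAbove (φ a)
φ-supportBoundedAbove a = N , λ m _ ≢0 → bounded m ≢0
  where
  N = ℤ-Extrema.max ℤ.0ℤ (letterValues a)
  bounded : ∀ m → φ a m ≢ 0ℚ → All (ℤ._≤ N) m
  bounded m ≢0 with All.all? (ℤ._≤? N) m
  ... | yes m≤N = m≤N
  ... | no m≰N = ⊥-elim (≢0 (∑-zero a vanish))
    where
    vanish : ∀ {e} → e ∈ a → proj₁ e * slide (proj₂ e) m ≡ 0ℚ
    vanish {e} e∈ with ℚₚ._≟_ (proj₁ e * slide (proj₂ e) m) 0ℚ
    ... | yes ≡0 = ≡0
    ... | no term≢0 = ⊥-elim (m≰N (Pointwise-≤-All
      (compatible⇒≤vals (proj₂ e) m (slide≢0⇒compatible (proj₂ e) m (proj₁ e) term≢0))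
      (All.tabulate (λ v∈ → letter≤N (∈ₚ.∈-map⁻ val v∈)))))
      where
      letter≤N : ∀ {v} → ∃ (λ l → l ∈ proj₂ e × v ≡ val l) → v ℤ.≤ N
      letter≤N (l , l∈ , refl) = All.lookup (ℤ-Extrema.xs≤max ℤ.0ℤ (letterValues a)) (∈-letterValues a e∈ l∈)

module _ (M : ℤ) where

  admits-within : ∀ ℓ y x t → y ℤ.≤ x → x ℤ.≤ val t →
    admits (just (ℓ , y)) t x ≡ (if ℓ <L t then ℤ.suc y ≤ᵇ x else true)
  admits-within ℓ y x t y≤x x≤t rewrite ≤ᵇ-complete y≤x | ≤ᵇ-complete x≤t = Boolₚ.∧-identityʳ _

  -- Below M only the ascents of the entries matter, since every letter of t is above M.
  compatibleAfter-low-ascents : ∀ t ℓ y y' l l' h → ascents (y ∷ l) ≡ ascents (y' ∷ l') →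
    Sorted (y ∷ l) → Sorted (y' ∷ l') → All (ℤ._≤ M) (y ∷ l) → All (ℤ._≤ M) (y' ∷ l') →
    All (M ℤ.<_) h → All (λ q → M ℤ.< val q) t →
    compatibleAfter (just (ℓ , y)) t (l ++ h) ≡ compatibleAfter (just (ℓ , y')) t (l' ++ h)
  compatibleAfter-low-ascents [] ℓ y y' [] [] [] _ _ _ _ _ _ _ = refl
  compatibleAfter-low-ascents [] ℓ y y' [] [] (b ∷ h) _ _ _ _ _ _ _ = refl
  compatibleAfter-low-ascents (t ∷ ts) ℓ y y' [] [] [] _ _ _ _ _ _ _ = refl
  compatibleAfter-low-ascents (t ∷ ts) ℓ y y' [] [] (b ∷ h) _ _ _ (y≤M ∷ _) (y'≤M ∷ _) (M<b ∷ _) _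
    rewrite admits-above ℓ y t b (ℤₚ.≤-<-trans y≤M M<b) | admits-above ℓ y' t b (ℤₚ.≤-<-trans y'≤M M<b) = refl
  compatibleAfter-low-ascents t ℓ y y' [] (_ ∷ _) h () _ _ _ _ _ _
  compatibleAfter-low-ascents t ℓ y y' (_ ∷ _) [] h () _ _ _ _ _ _
  compatibleAfter-low-ascents [] ℓ y y' (x ∷ l) (x' ∷ l') h _ _ _ _ _ _ _ = refl
  compatibleAfter-low-ascents (t ∷ ts) ℓ y y' (x ∷ l) (x' ∷ l') h same (y≤x ∷ s) (y'≤x' ∷ s')
    (_ ∷ x≤M ∷ l≤M) (_ ∷ x'≤M ∷ l'≤M) M<h (M<t ∷ M<ts)
    rewrite admits-within ℓ y x t y≤x (ℤₚ.<⇒≤ (ℤₚ.≤-<-trans x≤M M<t))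
          | admits-within ℓ y' x' t y'≤x' (ℤₚ.<⇒≤ (ℤₚ.≤-<-trans x'≤M M<t))
          | Listₚ.∷-injectiveˡ same
          | compatibleAfter-low-ascents ts t x x' l l' h (Listₚ.∷-injectiveʳ same) s s' (x≤M ∷ l≤M) (x'≤M ∷ l'≤M) M<h M<ts = refl

  compatible-low-shape : ∀ t l l' h → SameShape l l' → Sorted l → Sorted l' → All (ℤ._≤ M) l → All (ℤ._≤ M) l' →
    All (M ℤ.<_) h → All (λ q → M ℤ.< val q) t → compatibleAfter nothing t (l ++ h) ≡ compatibleAfter nothing t (l' ++ h)
  compatible-low-shape t [] [] h both-[] _ _ _ _ _ _ = refl
  compatible-low-shape [] (x ∷ l) (x' ∷ l') h (both-∷ _) _ _ _ _ _ _ = refl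
  compatible-low-shape (t ∷ ts) (x ∷ l) (x' ∷ l') h (both-∷ same) s s' (x≤M ∷ l≤M) (x'≤M ∷ l'≤M) M<h (M<t ∷ M<ts)
    rewrite ≤ᵇ-complete (ℤₚ.<⇒≤ (ℤₚ.≤-<-trans x≤M M<t)) | ≤ᵇ-complete (ℤₚ.<⇒≤ (ℤₚ.≤-<-trans x'≤M M<t)) =
    compatibleAfter-low-ascents ts t x x' l l' h same s s' (x≤M ∷ l≤M) (x'≤M ∷ l'≤M) M<h M<ts

  compatible-quasisymmetric : ∀ t → All (λ q → M ℤ.< val q) t → ∀ m m' → Sorted m → Sorted m' →
    high M m ≡ high M m' → runs (low M m) ≡ runs (low M m') → compatible t m ≡ compatible t m'
  compatible-quasisymmetric t M<t m m' sm sm' same-high same-runs = begin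
    compatible t m                                  ≡⟨ cong (compatible t) (sorted-low++high M m sm) ⟩
    compatible t (low M m ++ high M m)              ≡⟨ compatible≡compatibleAfter t _ ⟩
    compatibleAfter nothing t (low M m ++ high M m)
      ≡⟨ compatible-low-shape t (low M m) (low M m') (high M m)
           (runs⇒SameShape (low M m) (low M m') sl sl' same-runs) sl sl' (low-≤ M m) (low-≤ M m') (high-> M m) M<t ⟩
    compatibleAfter nothing t (low M m' ++ high M m)  ≡⟨ cong (λ h → compatibleAfter nothing t (low M m' ++ h)) same-high ⟩
    compatibleAfter nothing t (low M m' ++ high M m') ≡⟨ compatible≡compatibleAfter t _ ⟨
    compatible t (low M m' ++ high M m')            ≡⟨ cong (compatible t) (sorted-low++high M m' sm') ⟨
    compatible t m'                                 ∎
    where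
    open ≡-Reasoning
    sl = Sorted-++ˡ (low M m) (high M m) (subst Sorted (sorted-low++high M m sm) sm)
    sl' = Sorted-++ˡ (low M m') (high M m') (subst Sorted (sorted-low++high M m' sm') sm')

φ-quasisymmetricBelow : ∀ a → ∃[ M ] QuasisymmetricBelow M (φ a)
φ-quasisymmetricBelow a = M , λ m m' sm sm' same-high same-runs → ∑-cong-∈ a (λ {e} e∈ →
  cong (λ b → proj₁ e * 𝟙 b) (compatible-quasisymmetric M (proj₂ e) (All.tabulate (λ l∈ → M<letter (∈-letterValues a e∈ l∈)))
    m m' sm sm' same-high same-runs))
  where
  M = ℤ-Extrema.min ℤ.0ℤ (letterValues a) ℤ.- ℤ.1ℤ
  M<letter : ∀ {v} → v ∈ letterValues a → M ℤ.< v
  M<letter v∈ = ℤₚ.<-≤-trans (≤-1⇒< ℤₚ.≤-refl) (All.lookup (ℤ-Extrema.min≤xs ℤ.0ℤ (letterValues a)) v∈)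

φ-backQSym : ∀ a → BackQSym (φ a)
φ-backQSym a = φ-boundedDegree a , φ-supportBoundedAbove a , φ-quasisymmetricBelow a

-- Surjectivity

_⊆ᵇ_ : List Bool → List Bool → Bool
[] ⊆ᵇ [] = true
[] ⊆ᵇ (_ ∷ _) = false
(_ ∷ _) ⊆ᵇ [] = false
(b ∷ π) ⊆ᵇ (s ∷ σ) = (if b then s else true) ∧ (π ⊆ᵇ σ)

-- Möbius inversion on the Boolean lattice: coefficients c_π with g σ = ∑_{π ⊆ σ} c_π.
mobius : (List Bool → ℚ) → ℕ → List (ℚ × List Bool)
mobius g zero = (g [] , []) ∷ []
mobius g (suc n) = map (map₂ (false ∷_)) (mobius (λ σ → g (false ∷ σ)) n)
  ++ map (map₂ (true ∷_)) (mobius (λ σ → g (true ∷ σ) - g (false ∷ σ)) n)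

length-mobius : ∀ g n {e} → e ∈ mobius g n → length (proj₂ e) ≡ n
length-mobius g zero (here refl) = refl
length-mobius g (suc n) e∈ with ∈ₚ.∈-++⁻ (map (map₂ (false ∷_)) (mobius (λ σ → g (false ∷ σ)) n)) e∈
... | inj₁ e∈₀ with ∈ₚ.∈-map⁻ (map₂ (false ∷_)) e∈₀
...   | _ , e'∈ , refl = cong suc (length-mobius _ n e'∈)
length-mobius g (suc n) e∈ | inj₂ e∈₁ with ∈ₚ.∈-map⁻ (map₂ (true ∷_)) e∈₁
...   | _ , e'∈ , refl = cong suc (length-mobius _ n e'∈)

mobius-inverts : ∀ g n σ → length σ ≡ n → ∑ (mobius g n) (λ e → proj₁ e * 𝟙 (proj₂ e ⊆ᵇ σ)) ≡ g σ
mobius-inverts g zero [] refl = trans (ℚₚ.+-identityʳ _) (ℚₚ.*-identityʳ (g []))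
mobius-inverts g (suc n) (s ∷ σ) len = begin
  ∑ (map (map₂ (false ∷_)) L₀ ++ map (map₂ (true ∷_)) L₁) F
    ≡⟨ ∑-++ (map (map₂ (false ∷_)) L₀) _ F ⟩
  ∑ (map (map₂ (false ∷_)) L₀) F + ∑ (map (map₂ (true ∷_)) L₁) F
    ≡⟨ cong₂ _+_ (∑-map (map₂ (false ∷_)) L₀ F) (∑-map (map₂ (true ∷_)) L₁ F) ⟩
  ∑ L₀ (λ e → proj₁ e * 𝟙 (proj₂ e ⊆ᵇ σ)) + ∑ L₁ (λ e → proj₁ e * 𝟙 (s ∧ (proj₂ e ⊆ᵇ σ)))
    ≡⟨ cong₂ _+_ (mobius-inverts g₀ n σ len') (upper s) ⟩
  g₀ σ + 𝟙 s * g₁ σ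
    ≡⟨ interpolate s ⟩
  g (s ∷ σ) ∎
  where
  open ≡-Reasoning
  len' = ℕₚ.suc-injective len
  g₀ g₁ : List Bool → ℚ
  g₀ σ = g (false ∷ σ)
  g₁ σ = g (true ∷ σ) - g (false ∷ σ)
  L₀ = mobius g₀ n
  L₁ = mobius g₁ n
  F = λ e → proj₁ e * 𝟙 (proj₂ e ⊆ᵇ (s ∷ σ))
  upper : ∀ s → ∑ L₁ (λ e → proj₁ e * 𝟙 (s ∧ (proj₂ e ⊆ᵇ σ))) ≡ 𝟙 s * g₁ σ
  upper true = trans (mobius-inverts g₁ n σ len') (sym (ℚₚ.*-identityˡ _))
  upper false = trans (∑-zero L₁ (λ {e} _ → ℚₚ.*-zeroʳ (proj₁ e))) (sym (ℚₚ.*-zeroˡ (g₁ σ)))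
  interpolate : ∀ s → g₀ σ + 𝟙 s * g₁ σ ≡ g (s ∷ σ)
  interpolate true = solve 2 (λ x y → x :+ con 1ℚ :* (y :- x) := y) refl (g (false ∷ σ)) (g (true ∷ σ))
  interpolate false = trans (cong (g₀ σ +_) (ℚₚ.*-zeroˡ (g₁ σ))) (ℚₚ.+-identityʳ _)

-- Its slide polynomial is the fundamental quasisymmetric function of π in the variables x_i, i ≤ M.
fundamentalWord : ℤ → ℕ → List Bool → CWord
fundamentalWord M c [] = (M , c) ∷ []
fundamentalWord M c (b ∷ π) = (M , c) ∷ fundamentalWord M (if b then suc c else c) π

fundamentalᵇ : ℤ → List Bool → List ℤ → Bool
fundamentalᵇ M [] (x ∷ []) = x ≤ᵇ M
fundamentalᵇ M [] [] = false
fundamentalᵇ M [] (_ ∷ _ ∷ _) = false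
fundamentalᵇ M (b ∷ π) [] = false
fundamentalᵇ M (b ∷ π) (_ ∷ []) = false
fundamentalᵇ M (b ∷ π) (x ∷ y ∷ r) =
  (x ≤ᵇ M) ∧ ((x ≤ᵇ y) ∧ ((if b then ℤ.suc x ≤ᵇ y else true) ∧ fundamentalᵇ M π (y ∷ r)))

fundamentalWord-∷ : ∀ M c π → ∃[ w ] fundamentalWord M c π ≡ (M , c) ∷ w
fundamentalWord-∷ M c [] = [] , refl
fundamentalWord-∷ M c (b ∷ π) = _ , refl

<L-colour-step : ∀ M c b → ((M , c) <L (M , (if b then suc c else c))) ≡ b
<L-colour-step M c true = ≺⇒<L (M , c) (M , suc c) (inj₂ (refl , ℕₚ.≤-refl))
<L-colour-step M c false = <L-irrefl (M , c)

compatible-fundamentalWord : ∀ M c π m → compatible (fundamentalWord M c π) m ≡ fundamentalᵇ M π m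
compatible-fundamentalWord M c [] [] = refl
compatible-fundamentalWord M c [] (x ∷ []) = refl
compatible-fundamentalWord M c [] (x ∷ y ∷ m) = refl
compatible-fundamentalWord M c (b ∷ π) m with fundamentalWord-∷ M (if b then suc c else c) π
  | compatible-fundamentalWord M (if b then suc c else c) π
... | w , eq | ih with m
...   | [] rewrite eq = refl
...   | x ∷ [] rewrite eq = refl
...   | x ∷ y ∷ m' rewrite sym (ih (y ∷ m')) | eq | <L-colour-step M c b = refl

fundamentalᵇ-[] : ∀ M π → fundamentalᵇ M π [] ≡ false
fundamentalᵇ-[] M [] = refl
fundamentalᵇ-[] M (b ∷ π) = refl

fundamentalᵇ-tail : ∀ M b π x y r → fundamentalᵇ M (b ∷ π) (x ∷ y ∷ r) ≡ true → fundamentalᵇ M π (y ∷ r) ≡ true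
fundamentalᵇ-tail M b π x y r e = ∧-trueʳ {if b then ℤ.suc x ≤ᵇ y else true} (∧-trueʳ {x ≤ᵇ y} (∧-trueʳ {x ≤ᵇ M} e))

fundamentalᵇ⇒≤ : ∀ M π m → fundamentalᵇ M π m ≡ true → All (ℤ._≤ M) m
fundamentalᵇ⇒≤ M [] (x ∷ []) e = ≤ᵇ-sound e ∷ []
fundamentalᵇ⇒≤ M (b ∷ π) (x ∷ y ∷ r) e = ≤ᵇ-sound (∧-trueˡ e)
  ∷ fundamentalᵇ⇒≤ M π (y ∷ r) (fundamentalᵇ-tail M b π x y r e)

fundamentalᵇ⇒length : ∀ M π m → fundamentalᵇ M π m ≡ true → length m ≡ suc (length π)
fundamentalᵇ⇒length M [] (x ∷ []) e = refl
fundamentalᵇ⇒length M (b ∷ π) (x ∷ y ∷ r) e =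
  cong suc (fundamentalᵇ⇒length M π (y ∷ r) (fundamentalᵇ-tail M b π x y r e))

fundamentalᵇ-ascents : ∀ M π x m → Sorted (x ∷ m) → All (ℤ._≤ M) (x ∷ m) → length m ≡ length π →
  fundamentalᵇ M π (x ∷ m) ≡ π ⊆ᵇ ascents (x ∷ m)
fundamentalᵇ-ascents M [] x [] _ (x≤M ∷ _) _ = ≤ᵇ-complete x≤M
fundamentalᵇ-ascents M (b ∷ π) x (y ∷ m) (x≤y ∷ s) (x≤M ∷ m≤M) len
  rewrite ≤ᵇ-complete x≤M | ≤ᵇ-complete x≤y | fundamentalᵇ-ascents M π y m s m≤M (ℕₚ.suc-injective len) = refl

representativeHead : ℤ → List Bool → ℤ
representativeHead M [] = M
representativeHead M (b ∷ σ) = if b then representativeHead M σ ℤ.- ℤ.1ℤ else representativeHead M σ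

representative : ℤ → List Bool → List ℤ
representative M [] = M ∷ []
representative M (b ∷ σ) = representativeHead M (b ∷ σ) ∷ representative M σ

representative-∷ : ∀ M σ → ∃[ w ] representative M σ ≡ representativeHead M σ ∷ w
representative-∷ M [] = [] , refl
representative-∷ M (b ∷ σ) = representative M σ , refl

representativeHead-step : ∀ M b σ → representativeHead M (b ∷ σ) ℤ.≤ representativeHead M σ
representativeHead-step M true σ = ℤₚ.<⇒≤ (≤-1⇒< ℤₚ.≤-refl)
representativeHead-step M false σ = ℤₚ.≤-refl

representativeHead≤ : ∀ M σ → representativeHead M σ ℤ.≤ M
representativeHead≤ M [] = ℤₚ.≤-refl
representativeHead≤ M (b ∷ σ) = ℤₚ.≤-trans (representativeHead-step M b σ) (representativeHead≤ M σ)

representative≤ : ∀ M σ → All (ℤ._≤ M) (representative M σ)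
representative≤ M [] = ℤₚ.≤-refl ∷ []
representative≤ M (b ∷ σ) = representativeHead≤ M (b ∷ σ) ∷ representative≤ M σ

representative-sorted : ∀ M σ → Sorted (representative M σ)
representative-sorted M [] = [-]
representative-sorted M (b ∷ σ) with representative-∷ M σ | representative-sorted M σ
... | w , eq | sorted rewrite eq = representativeHead-step M b σ ∷ sorted

ascents-representative : ∀ M σ → ascents (representative M σ) ≡ σ
ascents-representative M [] = refl
ascents-representative M (b ∷ σ) with representative-∷ M σ | ascents-representative M σ
... | w , eq | ih rewrite eq = cong₂ _∷_ (ascent b) ih
  where
  ascent : ∀ b → (ℤ.suc (representativeHead M (b ∷ σ)) ≤ᵇ representativeHead M σ) ≡ b
  h = representativeHead M σ
  ascent true = ≤ᵇ-complete {ℤ.suc (h ℤ.- ℤ.1ℤ)} {h} (ℤₚ.i<j⇒suc[i]≤j (≤-1⇒< ℤₚ.≤-refl))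
  ascent false = suc-≤ᵇ-false h

DegreeBound : ℕ → PS → Set
DegreeBound d f = ∀ m → Sorted m → d ℕ.< length m → f m ≡ 0ℚ

SupportBound : ℤ → PS → Set
SupportBound N f = ∀ m → Sorted m → f m ≢ 0ℚ → All (ℤ._≤ N) m

module QuasisymmetricExpansion (f : PS) (M : ℤ) (d : ℕ)
  (degree≤d : DegreeBound d f)
  (support≤M : ∀ m → Sorted m → ¬ All (ℤ._≤ M) m → f m ≡ 0ℚ)
  (quasisymmetric : QuasisymmetricBelow M f) where

  coefficients : List Bool → ℚ
  coefficients σ = f (representative M σ)

  homogeneousPart : ℕ → 𝒬
  homogeneousPart k = map (map₂ (fundamentalWord M 0)) (mobius coefficients k)

  partsBelow : ℕ → 𝒬
  partsBelow zero = []
  partsBelow (suc k) = homogeneousPart k ++ partsBelow k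

  expansion : 𝒬
  expansion = (f [] , []) ∷ partsBelow d

  φ-homogeneousPart : ∀ k m →
    φ (homogeneousPart k) m ≡ ∑ (mobius coefficients k) (λ e → proj₁ e * 𝟙 (fundamentalᵇ M (proj₂ e) m))
  φ-homogeneousPart k m = trans (∑-map (map₂ (fundamentalWord M 0)) (mobius coefficients k) _)
    (∑-cong (mobius coefficients k) (λ e → cong (λ b → proj₁ e * 𝟙 b) (compatible-fundamentalWord M 0 (proj₂ e) m)))

  φ-homogeneousPart-0 : ∀ k m → (∀ π → length π ≡ k → fundamentalᵇ M π m ≡ false) → φ (homogeneousPart k) m ≡ 0ℚ
  φ-homogeneousPart-0 k m incompatible = trans (φ-homogeneousPart k m) (∑-zero (mobius coefficients k) (λ {e} e∈ →
    trans (cong (λ b → proj₁ e * 𝟙 b) (incompatible (proj₂ e) (length-mobius coefficients k e∈))) (ℚₚ.*-zeroʳ (proj₁ e))))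

  f-representative : ∀ x m → Sorted (x ∷ m) → All (ℤ._≤ M) (x ∷ m) → f (representative M (ascents (x ∷ m))) ≡ f (x ∷ m)
  f-representative x m sm m≤M with representative-∷ M (ascents (x ∷ m))
  ... | w , eq = quasisymmetric r (x ∷ m) sr sm
    (trans (high-none M r (representative≤ M σ)) (sym (high-none M (x ∷ m) m≤M)))
    (begin
      runs (low M r)  ≡⟨ cong runs (low-all M r (representative≤ M σ)) ⟩
      runs r          ≡⟨ SameShape⇒runs r (x ∷ m) sr sm (subst (λ r' → SameShape r' (x ∷ m)) (sym eq)
                          (both-∷ (trans (cong ascents (sym eq)) (ascents-representative M σ)))) ⟩
      runs (x ∷ m)    ≡⟨ cong runs (low-all M (x ∷ m) m≤M) ⟨
      runs (low M (x ∷ m)) ∎)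
    where
    open ≡-Reasoning
    σ = ascents (x ∷ m)
    r = representative M σ
    sr = representative-sorted M σ

  φ-homogeneousPart-low : ∀ k x m → Sorted (x ∷ m) → All (ℤ._≤ M) (x ∷ m) →
    φ (homogeneousPart k) (x ∷ m) ≡ (if ⌊ k ℕₚ.≟ length m ⌋ then f (x ∷ m) else 0ℚ)
  φ-homogeneousPart-low k x m sm m≤M with k ℕₚ.≟ length m
  ... | yes refl = begin
    φ (homogeneousPart k) (x ∷ m)
      ≡⟨ φ-homogeneousPart k (x ∷ m) ⟩
    ∑ (mobius coefficients k) (λ e → proj₁ e * 𝟙 (fundamentalᵇ M (proj₂ e) (x ∷ m)))
      ≡⟨ ∑-cong-∈ (mobius coefficients k) (λ {e} e∈ → cong (λ b → proj₁ e * 𝟙 b)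
           (fundamentalᵇ-ascents M (proj₂ e) x m sm m≤M (sym (length-mobius coefficients k e∈)))) ⟩
    ∑ (mobius coefficients k) (λ e → proj₁ e * 𝟙 (proj₂ e ⊆ᵇ ascents (x ∷ m)))
      ≡⟨ mobius-inverts coefficients k (ascents (x ∷ m)) (length-ascents x m) ⟩
    f (representative M (ascents (x ∷ m)))
      ≡⟨ f-representative x m sm m≤M ⟩
    f (x ∷ m) ∎
    where open ≡-Reasoning
  ... | no k≢ = φ-homogeneousPart-0 k (x ∷ m) (λ π len → ¬true⇒false (λ e →
    k≢ (trans (sym len) (sym (ℕₚ.suc-injective (fundamentalᵇ⇒length M π (x ∷ m) e))))))

  φ-partsBelow-[] : ∀ k → φ (partsBelow k) [] ≡ 0ℚ
  φ-partsBelow-[] zero = refl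
  φ-partsBelow-[] (suc k) = trans (φ-+ (homogeneousPart k) (partsBelow k) [])
    (trans (cong₂ _+_ (φ-homogeneousPart-0 k [] (λ π _ → fundamentalᵇ-[] M π)) (φ-partsBelow-[] k)) refl)

  φ-partsBelow-high : ∀ k m → ¬ All (ℤ._≤ M) m → φ (partsBelow k) m ≡ 0ℚ
  φ-partsBelow-high zero m _ = refl
  φ-partsBelow-high (suc k) m m≰M = trans (φ-+ (homogeneousPart k) (partsBelow k) m)
    (trans (cong₂ _+_ (φ-homogeneousPart-0 k m (λ π _ → ¬true⇒false (λ e → m≰M (fundamentalᵇ⇒≤ M π m e))))
                      (φ-partsBelow-high k m m≰M)) refl)

  φ-partsBelow-low : ∀ k x m → Sorted (x ∷ m) → All (ℤ._≤ M) (x ∷ m) →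
    φ (partsBelow k) (x ∷ m) ≡ (if ⌊ length m ℕ.<? k ⌋ then f (x ∷ m) else 0ℚ)
  φ-partsBelow-low zero x m _ _ = refl
  φ-partsBelow-low (suc k) x m sm m≤M
    rewrite φ-+ (homogeneousPart k) (partsBelow k) (x ∷ m) | φ-homogeneousPart-low k x m sm m≤M | φ-partsBelow-low k x m sm m≤M
    with ℕₚ.<-cmp k (length m)
  ... | tri< k<m _ _ rewrite ⌊⌋-false (k ℕₚ.≟ length m) (λ e → ℕₚ.<-irrefl e k<m)
                           | ⌊⌋-false (length m ℕ.<? k) (λ m<k → ℕₚ.<-asym m<k k<m)
                           | ⌊⌋-false (length m ℕ.<? suc k) (λ m<k+1 → ℕₚ.<⇒≱ k<m (ℕₚ.≤-pred m<k+1)) = refl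
  ... | tri≈ _ refl _ rewrite ⌊⌋-true (k ℕₚ.≟ k) refl
                            | ⌊⌋-false (k ℕ.<? k) (ℕₚ.<-irrefl refl)
                            | ⌊⌋-true (k ℕ.<? suc k) ℕₚ.≤-refl = ℚₚ.+-identityʳ _
  ... | tri> _ _ m<k rewrite ⌊⌋-false (k ℕₚ.≟ length m) (λ e → ℕₚ.<-irrefl (sym e) m<k)
                           | ⌊⌋-true (length m ℕ.<? k) m<k
                           | ⌊⌋-true (length m ℕ.<? suc k) (ℕₚ.m≤n⇒m≤1+n m<k) = ℚₚ.+-identityˡ _

  φ-expansion : φ expansion ≈PS f
  φ-expansion [] _ = trans (cong₂ _+_ (ℚₚ.*-identityʳ (f [])) (φ-partsBelow-[] d)) (ℚₚ.+-identityʳ (f []))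
  φ-expansion (x ∷ m) sm with All.all? (ℤ._≤? M) (x ∷ m)
  ... | no m≰M = trans (cong₂ _+_ (ℚₚ.*-zeroʳ (f [])) (φ-partsBelow-high d (x ∷ m) m≰M)) (sym (support≤M (x ∷ m) sm m≰M))
  ... | yes m≤M = trans (cong₂ _+_ (ℚₚ.*-zeroʳ (f [])) (φ-partsBelow-low d x m sm m≤M))
                        (trans (ℚₚ.+-identityˡ _) (within (length m ℕ.<? d)))
    where
    within : (short? : Dec (length m ℕ.< d)) → (if ⌊ short? ⌋ then f (x ∷ m) else 0ℚ) ≡ f (x ∷ m)
    within (yes _) = refl
    within (no long) = sym (degree≤d (x ∷ m) sm (ℕ.s≤s (ℕₚ.≮⇒≥ long)))

length-insert : ∀ N v → length (insert N v) ≡ suc (length v)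
length-insert N v = Permₚ.↭-length (insert-↭ N v)

All-insert⁻ : ∀ {P : ℤ → Set} N v → All P (insert N v) → All P v
All-insert⁻ N v all = All.tail (Permₚ.All-resp-↭ (insert-↭ N v) all)

deleteFirst : ℤ → List ℤ → List ℤ
deleteFirst N [] = []
deleteFirst N (x ∷ m) = if ⌊ x ℤ.≟ N ⌋ then m else x ∷ deleteFirst N m

insert-deleteFirst : ∀ N m → Sorted m → N ∈ m → insert N (deleteFirst N m) ≡ m
insert-deleteFirst N (x ∷ m) sm N∈ with x ℤ.≟ N
insert-deleteFirst N (x ∷ []) _ _ | yes refl = refl
insert-deleteFirst N (x ∷ y ∷ m) (x≤y ∷ _) _ | yes refl with N ℤ.≤? y
... | yes _ = refl
... | no N≰y = ⊥-elim (N≰y x≤y)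
insert-deleteFirst N (x ∷ m) sm N∈ | no x≢N with N∈
... | here N≡x = ⊥-elim (x≢N (sym N≡x))
... | there N∈m with N ℤ.≤? x
...   | yes N≤x = ⊥-elim (x≢N (ℤₚ.≤-antisym (Sorted-∈ sm N∈m) N≤x))
...   | no _ = cong (x ∷_) (insert-deleteFirst N m (Linked.tail sm) N∈m)

Split-deleteFirst : ∀ N m → N ∈ m → Split m (N ∷ []) (deleteFirst N m)
Split-deleteFirst N (x ∷ m) N∈ with x ℤ.≟ N
... | yes refl = x ∷ˡ Split-allʳ m
... | no x≢N with N∈
...   | here N≡x = ⊥-elim (x≢N (sym N≡x))
...   | there N∈m = x ∷ʳ Split-deleteFirst N m N∈m

Sorted-head≤∈ : ∀ {y m x} → Sorted (y ∷ m) → x ∈ y ∷ m → y ℤ.≤ x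
Sorted-head≤∈ _ (here refl) = ℤₚ.≤-refl
Sorted-head≤∈ sm (there x∈) = Sorted-∈ sm x∈

-- In a sorted list the copies of N are adjacent, so removing any one of them removes the first.
Split-single-head : ∀ x m v → Sorted (x ∷ m) → Split (x ∷ m) (x ∷ []) v → v ≡ m
Split-single-head x m v _ (x ∷ˡ s) = Split-[]ˡ s
Split-single-head x (y ∷ m) (x ∷ v) (x≤y ∷ sm) (x ∷ʳ s) with ℤₚ.≤-antisym x≤y (Sorted-head≤∈ sm (Split-⊆ˡ s (here refl)))
... | refl = cong (x ∷_) (Split-single-head x m v sm s)

Split-single : ∀ N m v → Sorted m → Split m (N ∷ []) v → v ≡ deleteFirst N m
Split-single N (x ∷ m) v _ (x ∷ˡ s) rewrite ⌊⌋-true (x ℤ.≟ x) refl = Split-[]ˡ s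
Split-single N (x ∷ m) (x ∷ v) sm (x ∷ʳ s) with x ℤ.≟ N
... | no _ = cong (x ∷_) (Split-single N m v (Linked.tail sm) s)
Split-single N (x ∷ y ∷ m) (x ∷ v) (x≤y ∷ sm) (x ∷ʳ s) | yes refl
  with ℤₚ.≤-antisym x≤y (Sorted-head≤∈ sm (Split-⊆ˡ s (here refl)))
... | refl = cong (x ∷_) (Split-single-head x m v sm s)

low-insert : ∀ M N v → M ℤ.< N → low M (insert N v) ≡ low M v
low-insert M N [] M<N = Listₚ.filter-reject (ℤ._≤? M) (λ N≤M → ℤₚ.<-irrefl refl (ℤₚ.<-≤-trans M<N N≤M))
low-insert M N (y ∷ v) M<N with N ℤ.≤? y
... | yes _ = Listₚ.filter-reject (ℤ._≤? M) (λ N≤M → ℤₚ.<-irrefl refl (ℤₚ.<-≤-trans M<N N≤M))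
... | no _ with y ℤ.≤? M
...   | yes _ = cong (y ∷_) (low-insert M N v M<N)
...   | no _ = low-insert M N v M<N

high-insert : ∀ M N v → M ℤ.< N → high M (insert N v) ≡ insert N (high M v)
high-insert M N [] M<N = Listₚ.filter-accept (ℤ.suc M ℤ.≤?_) (ℤₚ.i<j⇒suc[i]≤j M<N)
high-insert M N (y ∷ v) M<N with N ℤ.≤? y
... | yes N≤y rewrite Listₚ.filter-accept (ℤ.suc M ℤ.≤?_) {N} {y ∷ v} (ℤₚ.i<j⇒suc[i]≤j M<N)
                    | Listₚ.filter-accept (ℤ.suc M ℤ.≤?_) {y} {v} (ℤₚ.i<j⇒suc[i]≤j (ℤₚ.<-≤-trans M<N N≤y)) with N ℤ.≤? y
...   | yes _ = refl
...   | no N≰y = ⊥-elim (N≰y N≤y)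
high-insert M N (y ∷ v) M<N | no N≰y with ℤ.suc M ℤ.≤? y
...   | yes _ with N ℤ.≤? y
...     | yes N≤y = ⊥-elim (N≰y N≤y)
...     | no _ = cong (y ∷_) (high-insert M N v M<N)
high-insert M N (y ∷ v) M<N | no N≰y | no _ = high-insert M N v M<N

∈-high⁺ : ∀ M {N m} → M ℤ.< N → N ∈ m → N ∈ high M m
∈-high⁺ M M<N N∈ = ∈ₚ.∈-filter⁺ (ℤ.suc M ℤ.≤?_) N∈ (ℤₚ.i<j⇒suc[i]≤j M<N)

∈-high⁻ : ∀ M {N} m → N ∈ high M m → N ∈ m
∈-high⁻ M m N∈ = proj₁ (∈ₚ.∈-filter⁻ (ℤ.suc M ℤ.≤?_) {xs = m} N∈)

x𝒬 : ℤ → 𝒬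
x𝒬 N = word ((N , 0) ∷ []) -𝒬 word ((N ℤ.- ℤ.1ℤ , 0) ∷ [])

φ-x𝒬 : ∀ N u → φ (x𝒬 N) u ≡ 𝟙 ⌊ u ≟ˡ (N ∷ []) ⌋
φ-x𝒬 N [] = refl
φ-x𝒬 N (b ∷ c ∷ u) rewrite ⌊⌋-false ((b ∷ c ∷ u) ≟ˡ (N ∷ [])) (λ ()) = refl
φ-x𝒬 N (b ∷ []) with ℤₚ.<-cmp b N
... | tri< b<N _ _ rewrite ≤ᵇ-complete (ℤₚ.<⇒≤ b<N) | ≤ᵇ-complete (<⇒≤-1 b<N)
                         | ⌊⌋-false ((b ∷ []) ≟ˡ (N ∷ [])) (λ eq → ℤₚ.<-irrefl (Listₚ.∷-injectiveˡ eq) b<N) = refl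
... | tri≈ _ refl _ rewrite ≤ᵇ-refl b | ≤ᵇ-false {b} {b ℤ.- ℤ.1ℤ} (λ b≤b-1 → ℤₚ.<-irrefl refl (≤-1⇒< b≤b-1))
                         | ⌊⌋-true ((b ∷ []) ≟ˡ (b ∷ [])) refl = refl
... | tri> _ _ N<b rewrite ≤ᵇ-false {b} {N} (λ b≤N → ℤₚ.<-irrefl refl (ℤₚ.<-≤-trans N<b b≤N))
                         | ≤ᵇ-false {b} {N ℤ.- ℤ.1ℤ} (λ b≤N-1 → ℤₚ.<-asym N<b (≤-1⇒< b≤N-1))
                         | ⌊⌋-false ((b ∷ []) ≟ˡ (N ∷ [])) (λ eq → ℤₚ.<-irrefl (sym (Listₚ.∷-injectiveˡ eq)) N<b) = refl

∑-factorisations-single : ∀ N m (h : List ℤ → ℚ) → Sorted m →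
  ∑ (factorisations m) (λ k → 𝟙 ⌊ proj₁ k ≟ˡ (N ∷ []) ⌋ * h (proj₂ k))
    ≡ (if ⌊ N ∈? m ⌋ then h (deleteFirst N m) else 0ℚ)
∑-factorisations-single N m h sm = trans (∑-cong-∈ ks single) (occurs (N ∈? m))
  where
  open Grouping _≟ᴾ_ using (∑-≟-∈; ∑-≟-∉)
  ks = factorisations m
  k₀ = (N ∷ [] , deleteFirst N m)
  h₀ = h (deleteFirst N m)
  single : ∀ {k} → k ∈ ks → 𝟙 ⌊ proj₁ k ≟ˡ (N ∷ []) ⌋ * h (proj₂ k) ≡ (if ⌊ k₀ ≟ᴾ k ⌋ then h₀ else 0ℚ)
  single {u , v} k∈ with u ≟ˡ (N ∷ [])
  ... | yes refl rewrite Split-single N m v sm (factorisations→Split m k∈) | ⌊⌋-true (k₀ ≟ᴾ k₀) refl = ℚₚ.*-identityˡ _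
  ... | no u≢N rewrite ⌊⌋-false (k₀ ≟ᴾ (u , v)) (λ eq → u≢N (sym (cong proj₁ eq))) = ℚₚ.*-zeroˡ (h v)
  occurs : (N∈? : Dec (N ∈ m)) → ∑ ks (λ k → if ⌊ k₀ ≟ᴾ k ⌋ then h₀ else 0ℚ) ≡ (if ⌊ N∈? ⌋ then h₀ else 0ℚ)
  occurs (yes N∈) = ∑-≟-∈ ks (factorisations-unique m) k₀ (Split→factorisations (Split-deleteFirst N m N∈)) _
  occurs (no N∉) = ∑-≟-∉ ks k₀ (λ k₀∈ → N∉ (Split-⊆ˡ (factorisations→Split m k₀∈) (here refl))) _

module DivideByTopVariable (f : PS) (d : ℕ) (N M : ℤ) (M<N : M ℤ.< N)
  (degree : DegreeBound (suc d) f) (support : SupportBound N f) (qsym : QuasisymmetricBelow M f) where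

  quotient : PS
  quotient v = f (insert N v)

  remainder : PS
  remainder m = if ⌊ N ∈? m ⌋ then 0ℚ else f m

  quotient-degree : DegreeBound d quotient
  quotient-degree v sv long = degree (insert N v) (insert-↗ N sv) (subst (suc d ℕ.<_) (sym (length-insert N v)) (ℕ.s≤s long))

  quotient-support : SupportBound N quotient
  quotient-support v sv ≢0 = All-insert⁻ N v (support (insert N v) (insert-↗ N sv) ≢0)

  quotient-qsym : QuasisymmetricBelow M quotient
  quotient-qsym v v' sv sv' same-high same-runs = qsym (insert N v) (insert N v') (insert-↗ N sv) (insert-↗ N sv')
    (trans (high-insert M N v M<N) (trans (cong (insert N) same-high) (sym (high-insert M N v' M<N))))
    (trans (cong runs (low-insert M N v M<N)) (trans same-runs (sym (cong runs (low-insert M N v' M<N)))))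

  remainder-degree : DegreeBound (suc d) remainder
  remainder-degree m sm long with N ∈? m
  ... | yes _ = refl
  ... | no _ = degree m sm long

  remainder-support : SupportBound (N ℤ.- ℤ.1ℤ) remainder
  remainder-support m sm ≢0 with N ∈? m
  ... | yes _ = ⊥-elim (≢0 refl)
  ... | no N∉ = All.tabulate (λ {x} x∈ → <⇒≤-1 (ℤₚ.≤∧≢⇒< (All.lookup (support m sm ≢0) x∈) (λ { refl → N∉ x∈ })))

  remainder-qsym : QuasisymmetricBelow M remainder
  remainder-qsym m m' sm sm' same-high same-runs rewrite qsym m m' sm sm' same-high same-runs =
    cong (λ b → if b then 0ℚ else f m') (same-test (N ∈? m) (N ∈? m'))
    where
    same-test : (N∈?m : Dec (N ∈ m)) (N∈?m' : Dec (N ∈ m')) → ⌊ N∈?m ⌋ ≡ ⌊ N∈?m' ⌋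
    same-test (yes _) (yes _) = refl
    same-test (no _) (no _) = refl
    same-test (yes N∈) (no N∉) = ⊥-elim (N∉ (∈-high⁻ M m' (subst (N ∈_) same-high (∈-high⁺ M M<N N∈))))
    same-test (no N∉) (yes N∈) = ⊥-elim (N∉ (∈-high⁻ M m (subst (N ∈_) (sym same-high) (∈-high⁺ M M<N N∈))))

  recombine : ∀ a b → φ a ≈PS remainder → φ b ≈PS quotient → φ (a +𝒬 (x𝒬 N *𝒬 b)) ≈PS f
  recombine a b φa≈ φb≈ m sm = begin
    φ (a +𝒬 (x𝒬 N *𝒬 b)) m
      ≡⟨ φ-+ a (x𝒬 N *𝒬 b) m ⟩
    φ a m + φ (x𝒬 N *𝒬 b) m
      ≡⟨ cong₂ _+_ (φa≈ m sm) (φ-*𝒬 (x𝒬 N) b m sm) ⟩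
    remainder m + ∑ (factorisations m) (λ k → φ (x𝒬 N) (proj₁ k) * φ b (proj₂ k))
      ≡⟨ cong (remainder m +_) (∑-cong-∈ (factorisations m) (λ {k} k∈ → cong₂ _*_ (φ-x𝒬 N (proj₁ k))
           (φb≈ (proj₂ k) (Split-sortedʳ (factorisations→Split m k∈) sm)))) ⟩
    remainder m + ∑ (factorisations m) (λ k → 𝟙 ⌊ proj₁ k ≟ˡ (N ∷ []) ⌋ * quotient (proj₂ k))
      ≡⟨ cong (remainder m +_) (∑-factorisations-single N m quotient sm) ⟩
    remainder m + (if ⌊ N ∈? m ⌋ then quotient (deleteFirst N m) else 0ℚ)
      ≡⟨ split (N ∈? m) ⟩
    f m ∎
    where
    open ≡-Reasoning
    split : (N∈? : Dec (N ∈ m)) → (if ⌊ N∈? ⌋ then 0ℚ else f m) + (if ⌊ N∈? ⌋ then quotient (deleteFirst N m) else 0ℚ) ≡ f m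
    split (yes N∈) = trans (ℚₚ.+-identityˡ _) (cong f (insert-deleteFirst N m sm N∈))
    split (no _) = ℚₚ.+-identityʳ _

φ-constant : ∀ f → DegreeBound 0 f → φ ((f [] , []) ∷ []) ≈PS f
φ-constant f degree [] _ = trans (ℚₚ.+-identityʳ _) (ℚₚ.*-identityʳ (f []))
φ-constant f degree (x ∷ m) sm = trans (ℚₚ.+-identityʳ _) (trans (ℚₚ.*-zeroʳ (f [])) (sym (degree (x ∷ m) sm (ℕ.s≤s ℕ.z≤n))))

≤+∣-∣ : ∀ N M → N ℤ.≤ M ℤ.+ ℤ.+ ℤ.∣ N ℤ.- M ∣
≤+∣-∣ N M = subst (ℤ._≤ M ℤ.+ ℤ.+ ℤ.∣ N ℤ.- M ∣) M+[N-M]≡N (ℤₚ.+-monoʳ-≤ M (≤∣∣ (N ℤ.- M)))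
  where
  M+[N-M]≡N : M ℤ.+ (N ℤ.- M) ≡ N
  M+[N-M]≡N = trans (cong (λ i → M ℤ.+ i) (ℤₚ.+-comm N (ℤ.- M)))
    (trans (sym (ℤₚ.+-assoc M (ℤ.- M) N)) (trans (cong (ℤ._+ N) (ℤₚ.+-inverseʳ M)) (ℤₚ.+-identityˡ N)))
  ≤∣∣ : ∀ i → i ℤ.≤ ℤ.+ ℤ.∣ i ∣
  ≤∣∣ (ℤ.+ n) = ℤₚ.≤-refl
  ≤∣∣ ℤ.-[1+ n ] = ℤ.-≤+

≤+suc⇒-1≤+ : ∀ N M k → N ℤ.≤ M ℤ.+ ℤ.+ suc k → N ℤ.- ℤ.1ℤ ℤ.≤ M ℤ.+ ℤ.+ k
≤+suc⇒-1≤+ N M k N≤ = subst (N ℤ.- ℤ.1ℤ ℤ.≤_) (ℤₚ.+-assoc M (ℤ.+ suc k) ℤ.-1ℤ) (ℤₚ.+-monoˡ-≤ ℤ.-1ℤ N≤)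

-- Induction on the degree bound d and, for fixed d, on the gap k ≥ N - M between the support bound and
-- the quasisymmetry bound; once N ≤ M the function is quasisymmetric in all its variables.
φ-surjective-on : ∀ d k f N M → DegreeBound d f → SupportBound N f → QuasisymmetricBelow M f →
  N ℤ.≤ M ℤ.+ ℤ.+ k → Dec (N ℤ.≤ M) → ∃[ a ] φ a ≈PS f
φ-surjective-on zero k f N M degree _ _ _ _ = (f [] , []) ∷ [] , φ-constant f degree
φ-surjective-on (suc d) k f N M degree support qsym _ (yes N≤M) = expansion , φ-expansion
  where
  support≤M : ∀ m → Sorted m → ¬ All (ℤ._≤ M) m → f m ≡ 0ℚ
  support≤M m sm m≰M with ℚₚ._≟_ (f m) 0ℚ
  ... | yes ≡0 = ≡0
  ... | no ≢0 = ⊥-elim (m≰M (All.map (λ x≤N → ℤₚ.≤-trans x≤N N≤M) (support m sm ≢0)))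
  open QuasisymmetricExpansion f M (suc d) degree support≤M qsym
φ-surjective-on (suc d) zero f N M _ _ _ N≤M+0 (no N≰M) = ⊥-elim (N≰M (subst (N ℤ.≤_) (ℤₚ.+-identityʳ M) N≤M+0))
φ-surjective-on (suc d) (suc k) f N M degree support qsym N≤M+k (no N≰M) =
  proj₁ remainder-solution +𝒬 (x𝒬 N *𝒬 proj₁ quotient-solution) ,
  recombine (proj₁ remainder-solution) (proj₁ quotient-solution) (proj₂ remainder-solution) (proj₂ quotient-solution)
  where
  open DivideByTopVariable f d N M (ℤₚ.≰⇒> N≰M) degree support qsym
  remainder-solution : ∃[ a ] φ a ≈PS remainder
  remainder-solution = φ-surjective-on (suc d) k remainder (N ℤ.- ℤ.1ℤ) M
    remainder-degree remainder-support remainder-qsym (≤+suc⇒-1≤+ N M k N≤M+k) (N ℤ.- ℤ.1ℤ ℤ.≤? M)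
  quotient-solution : ∃[ b ] φ b ≈PS quotient
  quotient-solution = φ-surjective-on d (suc k) quotient N M quotient-degree quotient-support quotient-qsym N≤M+k (N ℤ.≤? M)

φ-surjective : ∀ f → BackQSym f → ∃[ a ] φ a ≈PS f
φ-surjective f ((d , degree) , (N , support) , (M , qsym)) =
  φ-surjective-on d ℤ.∣ N ℤ.- M ∣ f N M degree support qsym (≤+∣-∣ N M) (N ℤ.≤? M)

proposition4p3 :
    (∀ a → BackQSym (φ a))
    × (∀ a b → a ≈𝒬 b → φ a ≈PS φ b)
    × (∀ a b → φ (a +𝒬 b) ≈PS (φ a +PS φ b))
    × (∀ c a m → φ (c ·𝒬 a) m ≡ c Data.Rational.* φ a m)
    × (φ 1𝒬 ≈PS 1PS)
    × (∀ a b → φ (a *𝒬 b) ≈PS (φ a *PS φ b))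
    × (∀ f → BackQSym f → ∃[ a ] φ a ≈PS f)
    × (∀ a → (φ a ≈PS 0PS) ⇔
         (Σ (List (ℚ × CWord × CWord)) λ L → All (λ { (c , p , q) → p ≡m q }) L
           × (a ≈𝒬 foldr _+𝒬_ [] (map (λ { (c , p , q) → c ·𝒬 (word p -𝒬 word q) }) L))))
proposition4p3 =
    φ-backQSym
  , (λ a b a≈b m _ → φ-resp-≈𝒬 a b a≈b m)
  , (λ a b m _ → φ-+ a b m)
  , φ-·
  , (λ m _ → φ-1 m)
  , φ-*𝒬
  , φ-surjective
  , (λ a → mk⇔ (kernel-⊆ a) (kernel-⊇ a))
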